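{- For every integer $k\geq 0$, $$\sum_{\iota\in\mathcal{I}_{2k+1}(123)} q^{\mathrm{coinv}(\iota)} = \sum_{j=1}^k q^{2j} A_{2j+1,k-j}(q^2) + \sum_{j=0}^k B_{2j+2,k-j}(q^2).$$
   Context: A permutation $\sigma$ of $[n]$ (one-line notation) contains a pattern $\pi\in\mathfrak{S}_k$ if some subsequence $\sigma(m_1)\cdots\sigma(m_k)$ with $m_1<\dots<m_k$ is in the same relative order as $\pi$; otherwise it avoids $\pi$. $\mathcal{I}_n(\pi)$ is the set of involutions ($\iota^2=\mathrm{id}$) of $[n]$ avoiding $\pi$. $\mathrm{coinv}(\sigma)$ is the number of pairs $i<j$ with $\sigma(i)<\sigma(j)$. For positive integers $m$ and $\ell\ge 0$, $A_{m,\ell}$ is the set of sequences $(a_1,\dots,a_\ell)$ of positive integers such that: (1) $a_1\le m$; (2) if $a_1,\dots,a_i$ are all equal to $1$ then $a_{i+1}\le m+i$; (3) if $a_i\ne 1$ and $a_{i+1},\dots,a_{i+r}$ are all equal to $1$ (for some $r\ge 0$) then $a_{i+r+1}\le a_i+r$. (For $\ell=0$, $A_{m,0}$ consists of the empty sequence.) Let $B_{m,\ell}=\{(a_1,\dots,a_\ell)\in A_{m,\ell}: a_1\neq 1\}$. Define $A_{m,\ell}(q)=\sum_{(a_1,\dots,a_\ell)\in A_{m,\ell}} q^{a_1+\dots+a_\ell-\ell}$ and $B_{m,\ell}(q)$ analogously over $B_{m,\ell}$. -}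

module Defs where

open import Data.Nat using (ℕ; zero; suc; _+_; _*_; _∸_; _≤_; _≤?_)
open import Data.Nat.Properties using (_≟_)
open import Data.Fin using (Fin; toℕ; _<_; _<?_)
import Data.Fin.Properties as FinP
open import Data.Fin.Properties using (any?; all?)
open import Data.Vec using (Vec; []; _∷_; lookup; toList)
open import Data.Nat.ListAction using (sum)
open import Data.List using (List; [_]; map; concatMap; filter; length; upTo; allFin; _++_)
open import Data.Product using (Σ; ∃; _×_; _,_)
open import Relation.Binary.PropositionalEquality using (_≡_; _≢_)
open import Relation.Nullary using (¬_; Dec)
open import Relation.Nullary.Decidable using (_×-dec_; _→-dec_; ¬?)

allVecs : (m n : ℕ) → List (Vec (Fin m) n)
allVecs m zero    = [ [] ]
allVecs m (suc n) = concatMap (λ x → map (x ∷_) (allVecs m n)) (allFin m)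

vecsFrom : List ℕ → (n : ℕ) → List (Vec ℕ n)
vecsFrom xs zero    = [ [] ]
vecsFrom xs (suc n) = concatMap (λ x → map (x ∷_) (vecsFrom xs n)) xs

-- Permutations / involutions of [n], in one-line notation as a Vec of
-- values; position i (0-based) has value lookup σ i.

IsInvolution : ∀ {n} → Vec (Fin n) n → Set
IsInvolution {n} σ = (i : Fin n) → lookup σ (lookup σ i) ≡ i

isInvolution? : ∀ {n} (σ : Vec (Fin n) n) → Dec (IsInvolution σ)
isInvolution? σ = all? (λ i → lookup σ (lookup σ i) FinP.≟ i)

Contains123 : ∀ {n} → Vec (Fin n) n → Set
Contains123 {n} σ = Σ (Fin n) λ i → Σ (Fin n) λ j → Σ (Fin n) λ k →
  (i < j × j < k) × (lookup σ i < lookup σ j × lookup σ j < lookup σ k)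

contains123? : ∀ {n} (σ : Vec (Fin n) n) → Dec (Contains123 σ)
contains123? σ = any? λ i → any? λ j → any? λ k →
  ((i <? j) ×-dec (j <? k)) ×-dec
  ((lookup σ i <? lookup σ j) ×-dec (lookup σ j <? lookup σ k))

Inv123 : (n : ℕ) → List (Vec (Fin n) n)
Inv123 n = filter (λ σ → ¬? (contains123? σ)) (filter isInvolution? (allVecs n n))

coinv : ∀ {n} → Vec (Fin n) n → ℕ
coinv {n} σ = length (filter (λ p → ((Data.Product.proj₁ p) <? (Data.Product.proj₂ p))
                                      ×-dec (lookup σ (Data.Product.proj₁ p) <? lookup σ (Data.Product.proj₂ p)))
                             (concatMap (λ i → map (λ j → i , j) (allFin n)) (allFin n)))

-- The sets A_{m,ℓ} and B_{m,ℓ}. A sequence (a_1,…,a_ℓ) is a Vec ℕ ℓ,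
-- with a_{p+1} = lookup a p for p : Fin ℓ (0-based positions).

Positive : ∀ {ℓ} → Vec ℕ ℓ → Set
Positive {ℓ} a = (p : Fin ℓ) → 1 ≤ lookup a p

-- conditions (1) and (2): if a_1,…,a_i are all 1 (i ≥ 0) then a_{i+1} ≤ m + i
-- (i = 0 is condition (1): a_1 ≤ m)
Cond12 : (m : ℕ) → ∀ {ℓ} → Vec ℕ ℓ → Set
Cond12 m {ℓ} a = (p : Fin ℓ) →
  ((q : Fin ℓ) → q < p → lookup a q ≡ 1) → lookup a p ≤ m + toℕ p

-- condition (3): if a_i ≠ 1 and a_{i+1},…,a_{i+r} are all 1 then
-- a_{i+r+1} ≤ a_i + r   (here i ↦ position s, i+r+1 ↦ position p, r = p - s - 1)
Cond3 : ∀ {ℓ} → Vec ℕ ℓ → Set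
Cond3 {ℓ} a = (s p : Fin ℓ) → s < p → lookup a s ≢ 1 →
  ((q : Fin ℓ) → s < q → q < p → lookup a q ≡ 1) →
  lookup a p ≤ lookup a s + (toℕ p ∸ toℕ s ∸ 1)

InA : (m : ℕ) → ∀ {ℓ} → Vec ℕ ℓ → Set
InA m a = Positive a × Cond12 m a × Cond3 a

inA? : (m : ℕ) → ∀ {ℓ} (a : Vec ℕ ℓ) → Dec (InA m a)
inA? m a =
  all? (λ p → 1 ≤? lookup a p)
  ×-dec all? (λ p → all? (λ q → (q <? p) →-dec (lookup a q ≟ 1)) →-dec (lookup a p ≤? m + toℕ p))
  ×-dec all? (λ s → all? λ p → (s <? p) →-dec (¬? (lookup a s ≟ 1) →-dec
          (all? (λ q → (s <? q) →-dec ((q <? p) →-dec (lookup a q ≟ 1)))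
           →-dec (lookup a p ≤? lookup a s + (toℕ p ∸ toℕ s ∸ 1)))))

-- B-condition: a_1 ≠ 1 (vacuous for the empty sequence)
FirstNotOne : ∀ {ℓ} → Vec ℕ ℓ → Set
FirstNotOne {ℓ} a = (p : Fin ℓ) → toℕ p ≡ 0 → lookup a p ≢ 1

firstNotOne? : ∀ {ℓ} (a : Vec ℕ ℓ) → Dec (FirstNotOne a)
firstNotOne? a = all? λ p → (toℕ p ≟ 0) →-dec ¬? (lookup a p ≟ 1)

-- Every element of A_{m,ℓ} has all entries in {1,…,m+ℓ} (each entry is at
-- most 1 more than the running bound, which starts at m), so A_{m,ℓ} is
-- obtained by filtering this finite superset.
candidates : (m ℓ : ℕ) → List (Vec ℕ ℓ)
candidates m ℓ = vecsFrom (map suc (upTo (m + ℓ))) ℓ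

Aset : (m ℓ : ℕ) → List (Vec ℕ ℓ)
Aset m ℓ = filter (inA? m) (candidates m ℓ)

Bset : (m ℓ : ℕ) → List (Vec ℕ ℓ)
Bset m ℓ = filter firstNotOne? (Aset m ℓ)

-- Polynomials in q with natural coefficients, represented by the list of
-- exponents of their monomials (a multiset); coefficient of q^d:
coeff : List ℕ → ℕ → ℕ
coeff es d = length (filter (λ e → e ≟ d) es)

wt : ∀ {ℓ} → Vec ℕ ℓ → ℕ
wt {ℓ} a = sum (toList a) ∸ ℓ

lhs : ℕ → List ℕ
lhs k = map coinv (Inv123 (suc (2 * k)))

rhs : ℕ → List ℕ
rhs k =
  concatMap (λ j → map (λ a → 2 * j + 2 * wt a) (Aset (2 * j + 1) (k ∸ j))) (map suc (upTo k))
  ++ concatMap (λ j → map (λ a → 2 * wt a) (Bset (2 * j + 2) (k ∸ j))) (upTo (suc k))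

module Submission where

-- Splitting off the first entry of a sequence gives
-- recursions for the coefficients of A_{m,ℓ} and B_{m,ℓ} (aCoeff, bCoeff),
-- and the enumerations Aset, Bset of Defs realise them (aCount, bCount).
--
-- A 123-avoiding involution G of [0, m + 2) with G 0 ≠ 0
-- arises from a 123-avoiding involution of [0, m) by inserting the 2-cycle
-- (0, b + 1) in front of a decreasing suffix (Insertion, Removal); if G 0 = 0,
-- G fixes 0 and reverses the rest (headFixed-unique).  So every such
-- involution grows from one fixing 0 along a unique history (Reach,
-- decompose, reach-length-unique).  An insertion adds 2(m - b) co-inversions
-- and changes the longest decreasing suffix in a controlled way, so histories
-- are counted by a generating-tree recursion (growCoeff, count-histories).
-- It is solved by aCoeff as long as the involution is not entirely
-- decreasing, and by a sum of bCoeff from the fixed point [0, 1)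
-- (growCoeff-partial, growCoeff-full).  Summing over the starting points of
-- odd size 2j + 1 gives the two sums of the theorem (lhs-coeff, rhs-coeff).
--
-- Involutions are handled as functions ℕ → ℕ on [0, n), related to the
-- vectors of Defs by fun and vec.

open import Defs
open import Data.Nat using (ℕ; zero; suc; pred; _+_; _*_; _∸_; _≤_; _<_; z≤n; s≤s; s<s⁻¹)
open import Data.Nat.Properties
open import Data.Fin using (Fin; toℕ; fromℕ<)
import Data.Fin as Fin
open import Data.Fin.Properties using (toℕ-fromℕ<; toℕ-injective; toℕ<n)
open import Data.Vec using (Vec; []; _∷_; lookup; toList; tabulate)
open import Data.Vec.Properties using (lookup∘tabulate; ∷-injective; ≡-dec)
open import Data.List using (List; []; _∷_; map; concatMap; filter; length; upTo; allFin; _++_)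
import Data.List as List
open import Data.List.Properties using (filter-accept; filter-reject; filter-++; filter-≐; length-++; map-∘; map-cong; map-applyUpTo)
open import Data.Nat.ListAction using (sum)
open import Data.Product using (Σ; ∃; _×_; _,_; proj₁; proj₂)
open import Data.Sum using (_⊎_; inj₁; inj₂)
open import Data.Empty using (⊥; ⊥-elim)
open import Relation.Binary.PropositionalEquality hiding ([_])
open import Relation.Nullary using (¬_; Dec; yes; no; does; _×-dec_; _→-dec_)
open import Relation.Nullary.Decidable using (map′; ¬?)
open import Data.Bool using (if_then_else_)
open import Relation.Unary using (Decidable)
open import Relation.Binary using (tri<; tri≈; tri>)
open import Relation.Unary.Properties using (_∩?_; _∪?_)
open import Function using (_∘_; id)

count : {A : Set} {P : A → Set} → Decidable P → List A → ℕ
count P? xs = length (filter P? xs)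

𝟙 : {P : Set} → Dec P → ℕ
𝟙 P? = if does P? then 1 else 0

𝟙-yes : {P : Set} (P? : Dec P) → P → 𝟙 P? ≡ 1
𝟙-yes (yes _) _ = refl
𝟙-yes (no ¬p) p = ⊥-elim (¬p p)

𝟙-no : {P : Set} (P? : Dec P) → ¬ P → 𝟙 P? ≡ 0
𝟙-no (yes p) ¬p = ⊥-elim (¬p p)
𝟙-no (no _)  _  = refl

𝟙-cong : {P Q : Set} (P? : Dec P) (Q? : Dec Q) → (P → Q) → (Q → P) → 𝟙 P? ≡ 𝟙 Q?
𝟙-cong (yes p) Q? to _ = sym (𝟙-yes Q? (to p))
𝟙-cong (no ¬p) Q? _ fro = sym (𝟙-no Q? (¬p ∘ fro))

module _ {A : Set} {P : A → Set} (P? : Decidable P) where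

  count-accept : ∀ {x} xs → P x → count P? (x ∷ xs) ≡ suc (count P? xs)
  count-accept xs px = cong length (filter-accept P? px)

  count-reject : ∀ {x} xs → ¬ P x → count P? (x ∷ xs) ≡ count P? xs
  count-reject xs ¬px = cong length (filter-reject P? ¬px)

  count-++ : ∀ xs ys → count P? (xs ++ ys) ≡ count P? xs + count P? ys
  count-++ xs ys = trans (cong length (filter-++ P? xs ys)) (length-++ (filter P? xs))

  count-none : ∀ xs → (∀ x → ¬ P x) → count P? xs ≡ 0
  count-none []       _ = refl
  count-none (x ∷ xs) h = trans (count-reject xs (h x)) (count-none xs h)

  count-concatMap : {B : Set} (f : B → List A) (xs : List B) →
                    count P? (concatMap f xs) ≡ sum (map (count P? ∘ f) xs)
  count-concatMap f []       = refl
  count-concatMap f (x ∷ xs) =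
    trans (count-++ (f x) (concatMap f xs)) (cong (count P? (f x) +_) (count-concatMap f xs))

  count≡sum𝟙 : ∀ xs → count P? xs ≡ sum (map (𝟙 ∘ P?) xs)
  count≡sum𝟙 []       = refl
  count≡sum𝟙 (x ∷ xs) with P? x
  ... | yes _ = cong suc (count≡sum𝟙 xs)
  ... | no _  = count≡sum𝟙 xs

count-map : {A B : Set} {P : B → Set} (P? : Decidable P) (f : A → B) (xs : List A) →
            count P? (map f xs) ≡ count (P? ∘ f) xs
count-map P? f []       = refl
count-map P? f (x ∷ xs) with P? (f x)
... | yes _ = cong suc (count-map P? f xs)
... | no _  = count-map P? f xs

count-cong : {A : Set} {P Q : A → Set} (P? : Decidable P) (Q? : Decidable Q) (xs : List A) →
             (∀ x → P x → Q x) → (∀ x → Q x → P x) → count P? xs ≡ count Q? xs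
count-cong P? Q? xs to fro = cong length (filter-≐ P? Q? ((λ {x} → to x) , (λ {x} → fro x)) xs)

count-filter : {A : Set} {P Q : A → Set} (P? : Decidable P) (Q? : Decidable Q) (xs : List A) →
               count Q? (filter P? xs) ≡ count (P? ∩? Q?) xs
count-filter P? Q? [] = refl
count-filter {P = P} {Q} P? Q? (x ∷ xs) = by-cases (P? x) (Q? x)
  where
  by-cases : Dec (P x) → Dec (Q x) → count Q? (filter P? (x ∷ xs)) ≡ count (P? ∩? Q?) (x ∷ xs)
  by-cases (no ¬p) _ =
    trans (cong (count Q?) (filter-reject P? ¬p))
          (trans (count-filter P? Q? xs) (sym (count-reject (P? ∩? Q?) xs (¬p ∘ proj₁))))
  by-cases (yes p) (yes q) =
    trans (cong (count Q?) (filter-accept P? p))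
          (trans (count-accept Q? _ q)
          (trans (cong suc (count-filter P? Q? xs)) (sym (count-accept (P? ∩? Q?) xs (p , q)))))
  by-cases (yes p) (no ¬q) =
    trans (cong (count Q?) (filter-accept P? p))
          (trans (count-reject Q? _ ¬q)
          (trans (count-filter P? Q? xs) (sym (count-reject (P? ∩? Q?) xs (¬q ∘ proj₂)))))

count-∪ : {A : Set} {P Q : A → Set} (P? : Decidable P) (Q? : Decidable Q) (xs : List A) →
          (∀ x → P x → Q x → ⊥) → count (P? ∪? Q?) xs ≡ count P? xs + count Q? xs
count-∪ P? Q? [] _ = refl
count-∪ P? Q? (x ∷ xs) disj with P? x | Q? x
... | yes p | yes q = ⊥-elim (disj x p q)
... | yes _ | no _  = cong suc (count-∪ P? Q? xs disj)
... | no _  | yes _ = trans (cong suc (count-∪ P? Q? xs disj)) (sym (+-suc _ _))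
... | no _  | no _  = count-∪ P? Q? xs disj

Σ< : ℕ → (ℕ → ℕ) → ℕ
Σ< zero    f = 0
Σ< (suc n) f = f 0 + Σ< n (f ∘ suc)

Σ-cong : ∀ n {f g : ℕ → ℕ} → (∀ i → i < n → f i ≡ g i) → Σ< n f ≡ Σ< n g
Σ-cong zero    _  = refl
Σ-cong (suc n) eq = cong₂ _+_ (eq 0 (s≤s z≤n)) (Σ-cong n (λ i i<n → eq (suc i) (s≤s i<n)))

Σ-zero : ∀ n {f : ℕ → ℕ} → (∀ i → i < n → f i ≡ 0) → Σ< n f ≡ 0
Σ-zero zero    _  = refl
Σ-zero (suc n) eq = cong₂ _+_ (eq 0 (s≤s z≤n)) (Σ-zero n (λ i i<n → eq (suc i) (s≤s i<n)))

Σ-const1 : ∀ n → Σ< n (λ _ → 1) ≡ n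
Σ-const1 zero    = refl
Σ-const1 (suc n) = cong suc (Σ-const1 n)

Σ-+ : ∀ n (f g : ℕ → ℕ) → Σ< n (λ i → f i + g i) ≡ Σ< n f + Σ< n g
Σ-+ zero    f g = refl
Σ-+ (suc n) f g = begin
  (f 0 + g 0) + Σ< n (λ i → f (suc i) + g (suc i)) ≡⟨ cong ((f 0 + g 0) +_) (Σ-+ n (f ∘ suc) (g ∘ suc)) ⟩
  (f 0 + g 0) + (Σ< n (f ∘ suc) + Σ< n (g ∘ suc))  ≡⟨ +-assoc (f 0) (g 0) _ ⟩
  f 0 + (g 0 + (Σ< n (f ∘ suc) + Σ< n (g ∘ suc)))  ≡⟨ cong (f 0 +_) (+-comm (g 0) _) ⟩
  f 0 + ((Σ< n (f ∘ suc) + Σ< n (g ∘ suc)) + g 0)  ≡⟨ cong (f 0 +_) (+-assoc (Σ< n (f ∘ suc)) _ (g 0)) ⟩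
  f 0 + (Σ< n (f ∘ suc) + (Σ< n (g ∘ suc) + g 0))  ≡⟨ sym (+-assoc (f 0) _ _) ⟩
  (f 0 + Σ< n (f ∘ suc)) + (Σ< n (g ∘ suc) + g 0)  ≡⟨ cong (Σ< (suc n) f +_) (+-comm (Σ< n (g ∘ suc)) (g 0)) ⟩
  Σ< (suc n) f + Σ< (suc n) g                       ∎
  where open ≡-Reasoning

Σ-*ʳ : ∀ n (f : ℕ → ℕ) c → Σ< n (λ i → f i * c) ≡ Σ< n f * c
Σ-*ʳ zero    f c = refl
Σ-*ʳ (suc n) f c = trans (cong (f 0 * c +_) (Σ-*ʳ n (f ∘ suc) c)) (sym (*-distribʳ-+ c (f 0) _))

Σ-last : ∀ n f → Σ< (suc n) f ≡ Σ< n f + f n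
Σ-last zero    f = +-comm (f 0) 0
Σ-last (suc n) f = trans (cong (f 0 +_) (Σ-last n (f ∘ suc))) (sym (+-assoc (f 0) _ _))

Σ-split : ∀ m n f → Σ< (m + n) f ≡ Σ< m f + Σ< n (λ i → f (m + i))
Σ-split zero    n f = refl
Σ-split (suc m) n f = trans (cong (f 0 +_) (Σ-split m n (f ∘ suc))) (sym (+-assoc (f 0) _ _))

Σ-truncate : ∀ n k {f g : ℕ → ℕ} → k ≤ n → (∀ i → i < k → f i ≡ g i) →
             (∀ i → k ≤ i → i < n → f i ≡ 0) → Σ< n f ≡ Σ< k g
Σ-truncate n k {f} {g} k≤n agree vanish = begin
  Σ< n f                                ≡⟨ cong (λ l → Σ< l f) (sym (m+[n∸m]≡n k≤n)) ⟩
  Σ< (k + (n ∸ k)) f                    ≡⟨ Σ-split k (n ∸ k) f ⟩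
  Σ< k f + Σ< (n ∸ k) (λ i → f (k + i)) ≡⟨ cong₂ _+_ (Σ-cong k agree) (Σ-zero (n ∸ k) tail-vanishes) ⟩
  Σ< k g + 0                            ≡⟨ +-identityʳ _ ⟩
  Σ< k g                                ∎
  where
  open ≡-Reasoning
  tail-vanishes : ∀ i → i < n ∸ k → f (k + i) ≡ 0
  tail-vanishes i i<n∸k = vanish (k + i) (m≤m+n k i) (subst (k + i <_) (m+[n∸m]≡n k≤n) (+-monoʳ-< k i<n∸k))

Σ-swap : ∀ m n (f : ℕ → ℕ → ℕ) → Σ< m (λ i → Σ< n (f i)) ≡ Σ< n (λ j → Σ< m (λ i → f i j))
Σ-swap zero    n f = sym (Σ-zero n (λ _ _ → refl))
Σ-swap (suc m) n f =
  trans (cong (Σ< n (f 0) +_) (Σ-swap m n (f ∘ suc))) (sym (Σ-+ n (f 0) (λ j → Σ< m (λ i → f (suc i) j))))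

sum-upTo : ∀ n (f : ℕ → ℕ) → sum (map f (upTo n)) ≡ Σ< n f
sum-upTo n f = trans (cong sum (map-applyUpTo id f n)) (go n f)
  where
  go : ∀ n (f : ℕ → ℕ) → sum (List.applyUpTo f n) ≡ Σ< n f
  go zero    f = refl
  go (suc n) f = cong (f 0 +_) (go n (f ∘ suc))

sum-allFin : ∀ n (f : Fin n → ℕ) (g : ℕ → ℕ) → (∀ i → f i ≡ g (toℕ i)) → sum (map f (allFin n)) ≡ Σ< n g
sum-allFin n f g eq = go n id eq
  where
  go : ∀ k (h : Fin k → Fin n) {g : ℕ → ℕ} → (∀ i → f (h i) ≡ g (toℕ i)) → sum (map f (List.tabulate h)) ≡ Σ< k g
  go zero    h eq = refl
  go (suc k) h eq = cong₂ _+_ (eq Fin.zero) (go k (h ∘ Fin.suc) (eq ∘ Fin.suc))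

Σ-pick : ∀ n a (φ : ℕ → ℕ) → a < n → Σ< n (λ v → 𝟙 (a ≟ v) * φ v) ≡ φ a
Σ-pick (suc n) zero    φ _ =
  trans (cong (φ 0 + 0 +_) (Σ-zero n (λ _ _ → refl))) (trans (+-identityʳ _) (+-identityʳ _))
Σ-pick (suc n) (suc a) φ (s≤s a<n) = Σ-pick n a (φ ∘ suc) a<n

Σ-involution : ∀ n (F φ : ℕ → ℕ) → (∀ i → i < n → F i < n) → (∀ i → i < n → F (F i) ≡ i) →
               Σ< n (φ ∘ F) ≡ Σ< n φ
Σ-involution n F φ F<n FF≡ = begin
  Σ< n (φ ∘ F)                                      ≡⟨ Σ-cong n (λ j j<n → sym (Σ-pick n (F j) φ (F<n j j<n))) ⟩
  Σ< n (λ j → Σ< n (λ v → 𝟙 (F j ≟ v) * φ v))       ≡⟨ Σ-swap n n (λ j v → 𝟙 (F j ≟ v) * φ v) ⟩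
  Σ< n (λ v → Σ< n (λ j → 𝟙 (F j ≟ v) * φ v))       ≡⟨ Σ-cong n (λ v _ → Σ-*ʳ n (λ j → 𝟙 (F j ≟ v)) (φ v)) ⟩
  Σ< n (λ v → Σ< n (λ j → 𝟙 (F j ≟ v)) * φ v)       ≡⟨ Σ-cong n (λ v v<n → cong (_* φ v) (one-preimage v v<n)) ⟩
  Σ< n (λ v → 1 * φ v)                              ≡⟨ Σ-cong n (λ v _ → *-identityˡ (φ v)) ⟩
  Σ< n φ                                            ∎
  where
  open ≡-Reasoning
  -- the only preimage of v is F v
  one-preimage : ∀ v → v < n → Σ< n (λ j → 𝟙 (F j ≟ v)) ≡ 1
  one-preimage v v<n = trans (Σ-cong n same) (Σ-pick n (F v) (λ _ → 1) (F<n v v<n))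
    where
    same : ∀ j → j < n → 𝟙 (F j ≟ v) ≡ 𝟙 (F v ≟ j) * 1
    same j j<n = trans (𝟙-cong (F j ≟ v) (F v ≟ j) (λ e → trans (cong F (sym e)) (FF≡ j j<n))
                                                   (λ e → trans (cong F (sym e)) (FF≡ v v<n)))
                       (sym (*-identityʳ _))

count-∃ : {A : Set} {Q : ℕ → A → Set} (Q? : ∀ t → Decidable (Q t)) (n : ℕ) (xs : List A) →
          (∀ {t t'} x → t < n → t' < n → Q t x → Q t' x → t ≡ t') →
          count (λ x → anyUpTo? (λ t → Q? t x) n) xs ≡ Σ< n (λ t → count (Q? t) xs)
count-∃ Q? zero    xs unique = count-none _ xs (λ { x (_ , () , _) })
count-∃ {Q = Q} Q? (suc n) xs unique = begin
  count (λ x → anyUpTo? (λ t → Q? t x) (suc n)) xs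
    ≡⟨ count-cong _ (Below? ∪? Q? n) xs (λ x → split x) (λ x → join x) ⟩
  count (Below? ∪? Q? n) xs
    ≡⟨ count-∪ Below? (Q? n) xs (λ { x (t , t<n , q) q' → <-irrefl (unique x (m<n⇒m<1+n t<n) ≤-refl q q') t<n }) ⟩
  count Below? xs + count (Q? n) xs
    ≡⟨ cong (_+ count (Q? n) xs) (count-∃ Q? n xs (λ x t<n t'<n → unique x (m<n⇒m<1+n t<n) (m<n⇒m<1+n t'<n))) ⟩
  Σ< n (λ t → count (Q? t) xs) + count (Q? n) xs
    ≡⟨ sym (Σ-last n (λ t → count (Q? t) xs)) ⟩
  Σ< (suc n) (λ t → count (Q? t) xs) ∎
  where
  open ≡-Reasoning
  Below? = λ x → anyUpTo? (λ t → Q? t x) n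
  split : ∀ x → (∃ λ t → t < suc n × Q t x) → (∃ λ t → t < n × Q t x) ⊎ Q n x
  split x (t , t<1+n , q) with m<1+n⇒m<n∨m≡n t<1+n
  ... | inj₁ t<n  = inj₁ (t , t<n , q)
  ... | inj₂ refl = inj₂ q
  join : ∀ x → (∃ λ t → t < n × Q t x) ⊎ Q n x → ∃ λ t → t < suc n × Q t x
  join x (inj₁ (t , t<n , q)) = t , m<n⇒m<1+n t<n , q
  join x (inj₂ q)             = n , ≤-refl , q

positive-∷⁻ : ∀ {ℓ} x (v : Vec ℕ ℓ) → Positive (x ∷ v) → 1 ≤ x × Positive v
positive-∷⁻ x v pos = pos Fin.zero , pos ∘ Fin.suc

positive-∷⁺ : ∀ {ℓ} x (v : Vec ℕ ℓ) → 1 ≤ x → Positive v → Positive (x ∷ v)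
positive-∷⁺ x v 1≤x pos Fin.zero    = 1≤x
positive-∷⁺ x v 1≤x pos (Fin.suc p) = pos p

cond12-one⁻ : ∀ {ℓ} m (v : Vec ℕ ℓ) → Cond12 m (1 ∷ v) → Cond12 (suc m) v
cond12-one⁻ m v cond p ones = subst (lookup v p ≤_) (+-suc m (toℕ p)) (cond (Fin.suc p) ones′)
  where
  ones′ : ∀ q → q Fin.< Fin.suc p → lookup (1 ∷ v) q ≡ 1
  ones′ Fin.zero    _   = refl
  ones′ (Fin.suc q) q<p = ones q (s<s⁻¹ q<p)

cond12-one⁺ : ∀ {ℓ} m (v : Vec ℕ ℓ) → 1 ≤ m → Cond12 (suc m) v → Cond12 m (1 ∷ v)
cond12-one⁺ m v 1≤m cond Fin.zero    _    = subst (1 ≤_) (sym (+-identityʳ m)) 1≤m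
cond12-one⁺ m v 1≤m cond (Fin.suc p) ones =
  subst (lookup v p ≤_) (sym (+-suc m (toℕ p))) (cond p (λ q q<p → ones (Fin.suc q) (s≤s q<p)))

cond12-big⁻ : ∀ {ℓ} m x (v : Vec ℕ ℓ) → Cond12 m (x ∷ v) → x ≤ m
cond12-big⁻ m x v cond = subst (x ≤_) (+-identityʳ m) (cond Fin.zero (λ _ ()))

cond12-big⁺ : ∀ {ℓ} m x (v : Vec ℕ ℓ) → x ≢ 1 → x ≤ m → Cond12 m (x ∷ v)
cond12-big⁺ m x v x≢1 x≤m Fin.zero    _    = subst (x ≤_) (sym (+-identityʳ m)) x≤m
cond12-big⁺ m x v x≢1 x≤m (Fin.suc p) ones = ⊥-elim (x≢1 (ones Fin.zero (s≤s z≤n)))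

cond3-tail : ∀ {ℓ} x (v : Vec ℕ ℓ) → Cond3 (x ∷ v) → Cond3 v
cond3-tail x v cond s p s<p as≢1 ones = cond (Fin.suc s) (Fin.suc p) (s≤s s<p) as≢1 ones′
  where
  ones′ : ∀ q → Fin.suc s Fin.< q → q Fin.< Fin.suc p → lookup (x ∷ v) q ≡ 1
  ones′ (Fin.suc q) s<q q<p = ones q (s<s⁻¹ s<q) (s<s⁻¹ q<p)

cond3-one⁺ : ∀ {ℓ} (v : Vec ℕ ℓ) → Cond3 v → Cond3 (1 ∷ v)
cond3-one⁺ v cond Fin.zero    p           _   a≢1  _    = ⊥-elim (a≢1 refl)
cond3-one⁺ v cond (Fin.suc s) (Fin.suc p) s<p as≢1 ones =
  cond s p (s<s⁻¹ s<p) as≢1 (λ q s<q q<p → ones (Fin.suc q) (s≤s s<q) (s≤s q<p))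

cond3-big⁻ : ∀ {ℓ} x (v : Vec ℕ ℓ) → x ≢ 1 → Cond3 (x ∷ v) → Cond12 x v
cond3-big⁻ {ℓ} x v x≢1 cond p ones = cond Fin.zero (Fin.suc p) (s≤s z≤n) x≢1 ones′
  where
  ones′ : ∀ q → Fin.zero {ℓ} Fin.< q → q Fin.< Fin.suc p → lookup (x ∷ v) q ≡ 1
  ones′ (Fin.suc q) _ q<p = ones q (s<s⁻¹ q<p)

cond3-big⁺ : ∀ {ℓ} x (v : Vec ℕ ℓ) → Cond12 x v → Cond3 v → Cond3 (x ∷ v)
cond3-big⁺ x v cond12 cond Fin.zero    (Fin.suc p) _   _    ones = cond12 p (λ q q<p → ones (Fin.suc q) (s≤s z≤n) (s≤s q<p))
cond3-big⁺ x v cond12 cond (Fin.suc s) (Fin.suc p) s<p as≢1 ones =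
  cond s p (s<s⁻¹ s<p) as≢1 (λ q s<q q<p → ones (Fin.suc q) (s≤s s<q) (s≤s q<p))

inA-one⁻ : ∀ {ℓ} m (v : Vec ℕ ℓ) → InA (suc m) (1 ∷ v) → InA (2 + m) v
inA-one⁻ m v (pos , cond12 , cond3) =
  proj₂ (positive-∷⁻ 1 v pos) , cond12-one⁻ (suc m) v cond12 , cond3-tail 1 v cond3

inA-one⁺ : ∀ {ℓ} m (v : Vec ℕ ℓ) → InA (2 + m) v → InA (suc m) (1 ∷ v)
inA-one⁺ m v (pos , cond12 , cond3) =
  positive-∷⁺ 1 v (s≤s z≤n) pos , cond12-one⁺ (suc m) v (s≤s z≤n) cond12 , cond3-one⁺ v cond3

inA-big⁻ : ∀ {ℓ} m i (v : Vec ℕ ℓ) → InA m (2 + i ∷ v) → 2 + i ≤ m × InA (2 + i) v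
inA-big⁻ m i v (pos , cond12 , cond3) =
  cond12-big⁻ m (2 + i) v cond12 , proj₂ (positive-∷⁻ (2 + i) v pos) , cond3-big⁻ (2 + i) v (λ ()) cond3 , cond3-tail (2 + i) v cond3

inA-big⁺ : ∀ {ℓ} m i (v : Vec ℕ ℓ) → 2 + i ≤ m → InA (2 + i) v → InA m (2 + i ∷ v)
inA-big⁺ m i v 2+i≤m (pos , cond12 , cond3) =
  positive-∷⁺ (2 + i) v (s≤s z≤n) pos , cond12-big⁺ m (2 + i) v (λ ()) 2+i≤m , cond3-big⁺ (2 + i) v cond12 cond3

wt-∷ : ∀ {ℓ} x (v : Vec ℕ ℓ) → Positive v → wt (suc x ∷ v) ≡ x + wt v
wt-∷ x v pos = +-∸-assoc x (length≤sum v pos)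
  where
  length≤sum : ∀ {ℓ} (v : Vec ℕ ℓ) → Positive v → ℓ ≤ sum (toList v)
  length≤sum []      _   = z≤n
  length≤sum (x ∷ v) pos = +-mono-≤ (pos Fin.zero) (length≤sum v (pos ∘ Fin.suc))

shift-∷ : ∀ {ℓ} e x (v : Vec ℕ ℓ) → Positive v → e + 2 * wt (suc x ∷ v) ≡ e + 2 * x + 2 * wt v
shift-∷ e x v pos = begin
  e + 2 * wt (suc x ∷ v)   ≡⟨ cong (λ w → e + 2 * w) (wt-∷ x v pos) ⟩
  e + 2 * (x + wt v)       ≡⟨ cong (e +_) (*-distribˡ-+ 2 x (wt v)) ⟩
  e + (2 * x + 2 * wt v)   ≡⟨ sym (+-assoc e (2 * x) _) ⟩
  e + 2 * x + 2 * wt v     ∎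
  where open ≡-Reasoning

shift-one : ∀ {ℓ} e (v : Vec ℕ ℓ) → Positive v → e + 2 * wt (1 ∷ v) ≡ e + 2 * wt v
shift-one e v pos = trans (shift-∷ e 0 v pos) (cong (_+ 2 * wt v) (+-identityʳ e))

-- aCoeff m ℓ e c is the coefficient of q^c in q^e A_{m,ℓ}(q²), bCoeff the one
-- in q^e B_{m,ℓ}(q²), computed by splitting off the first entry: a₁ = 1 leaves
-- a sequence of A_{m+1,ℓ-1}; a₁ = 2 + i ≤ m leaves a sequence of A_{2+i,ℓ-1}
-- and contributes weight 1 + i.  The sequences of B are those of the second kind.
aCoeff bCoeff : ℕ → ℕ → ℕ → ℕ → ℕ
aCoeff m zero    e c = 𝟙 (e ≟ c)
aCoeff m (suc ℓ) e c = aCoeff (suc m) ℓ e c + bCoeff m (suc ℓ) e c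
bCoeff m zero    e c = 𝟙 (e ≟ c)
bCoeff m (suc ℓ) e c = Σ< (m ∸ 1) (λ i → aCoeff (2 + i) ℓ (e + 2 * suc i) c)

AAt : ℕ → ℕ → ℕ → ∀ {ℓ} → Vec ℕ ℓ → Set
AAt m e c v = InA m v × e + 2 * wt v ≡ c

AAt? : ∀ m e c {ℓ} → Decidable (AAt m e c {ℓ})
AAt? m e c = inA? m ∩? (λ v → e + 2 * wt v ≟ c)

BAt : ℕ → ℕ → ℕ → ∀ {ℓ} → Vec ℕ ℓ → Set
BAt m e c v = InA m v × (FirstNotOne v × e + 2 * wt v ≡ c)

BAt? : ∀ m e c {ℓ} → Decidable (BAt m e c {ℓ})
BAt? m e c = inA? m ∩? (firstNotOne? ∩? (λ v → e + 2 * wt v ≟ c))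

values : ℕ → List ℕ
values N = map suc (upTo N)

count-by-head : ∀ N ℓ {P : Vec ℕ (suc ℓ) → Set} (P? : Decidable P) →
  let V = vecsFrom (values (suc N)) ℓ in
  count P? (vecsFrom (values (suc N)) (suc ℓ)) ≡
  count (λ v → P? (1 ∷ v)) V + Σ< N (λ i → count (λ v → P? (2 + i ∷ v)) V)
count-by-head N ℓ P? = begin
  count P? (concatMap (λ x → map (x ∷_) V) (values (suc N)))
    ≡⟨ count-concatMap P? (λ x → map (x ∷_) V) (values (suc N)) ⟩
  sum (map (λ x → count P? (map (x ∷_) V)) (values (suc N)))
    ≡⟨ cong sum (map-cong (λ x → count-map P? (x ∷_) V) (values (suc N))) ⟩
  sum (map atHead (map suc (upTo (suc N))))
    ≡⟨ cong sum (sym (map-∘ (upTo (suc N)))) ⟩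
  sum (map (atHead ∘ suc) (upTo (suc N)))
    ≡⟨ sum-upTo (suc N) (atHead ∘ suc) ⟩
  atHead 1 + Σ< N (λ i → atHead (2 + i)) ∎
  where
  open ≡-Reasoning
  V = vecsFrom (values (suc N)) ℓ
  atHead : ℕ → ℕ
  atHead x = count (λ v → P? (x ∷ v)) V

count-empty : {P : Vec ℕ 0 → Set} (P? : Decidable P) (xs : List ℕ) (e c : ℕ) →
              (P [] → e ≡ c) → (e ≡ c → P []) → count P? (vecsFrom xs 0) ≡ 𝟙 (e ≟ c)
count-empty P? xs e c to fro =
  trans (count≡sum𝟙 P? ([] ∷ [])) (trans (+-identityʳ _) (𝟙-cong (P? []) (e ≟ c) to fro))

inA-[] : ∀ m → InA m []
inA-[] m = (λ ()) , (λ ()) , (λ ())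

-- Enumerating A_{m,ℓ} inside any box {1, …, N}^ℓ with m + ℓ ≤ N (m ≥ 1).
-- The part with first entry ≥ 2 is shared with the enumeration of B.
aCount : ∀ ℓ N m e c → suc m + ℓ ≤ N →
         count (AAt? (suc m) e c) (vecsFrom (values N) ℓ) ≡ aCoeff (suc m) ℓ e c
bigHeadCount : ∀ ℓ N m e c → suc m + suc ℓ ≤ suc N →
  Σ< N (λ i → count (λ v → AAt? (suc m) e c (2 + i ∷ v)) (vecsFrom (values (suc N)) ℓ)) ≡ bCoeff (suc m) (suc ℓ) e c

aCount zero    N       m e c _     =
  count-empty (AAt? (suc m) e c) (values N) e c (λ (_ , eq) → trans (sym (+-identityʳ e)) eq)
                                                (λ eq → inA-[] (suc m) , trans (+-identityʳ e) eq)
aCount (suc ℓ) (suc N) m e c bound =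
  trans (count-by-head N ℓ (AAt? (suc m) e c)) (cong₂ _+_ headOne (bigHeadCount ℓ N m e c bound))
  where
  V = vecsFrom (values (suc N)) ℓ
  headOne : count (λ v → AAt? (suc m) e c (1 ∷ v)) V ≡ aCoeff (2 + m) ℓ e c
  headOne = trans
    (count-cong _ (AAt? (2 + m) e c) V
      (λ v (inA , eq) → let inA′ = inA-one⁻ m v inA in inA′ , trans (sym (shift-one e v (proj₁ inA′))) eq)
      (λ v (inA , eq) → inA-one⁺ m v inA , trans (shift-one e v (proj₁ inA)) eq))
    (aCount ℓ (suc N) (suc m) e c (subst (_≤ suc N) (+-suc (suc m) ℓ) bound))

bigHeadCount ℓ N m e c bound = Σ-truncate N m m≤N headIn headOut
  where
  V = vecsFrom (values (suc N)) ℓ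
  m≤N : m ≤ N
  m≤N = ≤-trans (m≤m+n m (suc ℓ)) (≤-pred bound)
  headIn : ∀ i → i < m → count (λ v → AAt? (suc m) e c (2 + i ∷ v)) V ≡ aCoeff (2 + i) ℓ (e + 2 * suc i) c
  headIn i i<m = trans
    (count-cong _ (AAt? (2 + i) (e + 2 * suc i) c) V
      (λ v (inA , eq) → let (_ , inA′) = inA-big⁻ (suc m) i v inA in
                        inA′ , trans (sym (shift-∷ e (suc i) v (proj₁ inA′))) eq)
      (λ v (inA , eq) → inA-big⁺ (suc m) i v (s≤s i<m) inA , trans (shift-∷ e (suc i) v (proj₁ inA)) eq))
    (aCount ℓ (suc N) (suc i) (e + 2 * suc i) c (≤-trans (+-monoˡ-≤ ℓ (s≤s i<m)) (≤-trans (+-monoʳ-≤ (suc m) (n≤1+n ℓ)) bound)))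
  headOut : ∀ i → m ≤ i → i < N → count (λ v → AAt? (suc m) e c (2 + i ∷ v)) V ≡ 0
  headOut i m≤i _ = count-none _ V (λ v (inA , _) → <⇒≱ (s≤s (s≤s m≤i)) (proj₁ (inA-big⁻ (suc m) i v inA)))

bCount : ∀ ℓ N m e c → suc m + ℓ ≤ N →
         count (BAt? (suc m) e c) (vecsFrom (values N) ℓ) ≡ bCoeff (suc m) ℓ e c
bCount zero    N       m e c _     =
  count-empty (BAt? (suc m) e c) (values N) e c (λ (_ , _ , eq) → trans (sym (+-identityʳ e)) eq)
                                                (λ eq → inA-[] (suc m) , (λ ()) , trans (+-identityʳ e) eq)
bCount (suc ℓ) (suc N) m e c bound =
  trans (count-by-head N ℓ (BAt? (suc m) e c)) (cong₂ _+_ headOne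
        (trans (Σ-cong N (λ i _ → count-cong _ _ V (λ v (inA , _ , eq) → inA , eq)
                                                  (λ v (inA , eq) → inA , firstBig i v , eq)))
               (bigHeadCount ℓ N m e c bound)))
  where
  V = vecsFrom (values (suc N)) ℓ
  headOne : count (λ v → BAt? (suc m) e c (1 ∷ v)) V ≡ 0
  headOne = count-none _ V (λ v (_ , first≢1 , _) → first≢1 Fin.zero refl refl)
  firstBig : ∀ i (v : Vec ℕ ℓ) → FirstNotOne (2 + i ∷ v)
  firstBig i v Fin.zero    _ ()
  firstBig i v (Fin.suc p) ()

-- Involutions are handled as functions ℕ → ℕ, meaningful on [0, n).  The
-- basic operation inserts a new 2-cycle (0, b + 1) in front of an involution
-- F of [0, m): the old points are renamed by sh b, which skips 0 and b + 1.

-- skip b enumerates ℕ ∖ {b} in increasing order; unskip b is its inverse.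
skip : ℕ → ℕ → ℕ
skip zero    x       = suc x
skip (suc b) zero    = zero
skip (suc b) (suc x) = suc (skip b x)

unskip : ℕ → ℕ → ℕ
unskip zero    y       = pred y
unskip (suc b) zero    = zero
unskip (suc b) (suc y) = suc (unskip b y)

unskip-skip : ∀ b x → unskip b (skip b x) ≡ x
unskip-skip zero    x       = refl
unskip-skip (suc b) zero    = refl
unskip-skip (suc b) (suc x) = cong suc (unskip-skip b x)

skip-unskip : ∀ b y → y ≢ b → skip b (unskip b y) ≡ y
skip-unskip zero    zero    y≢b = ⊥-elim (y≢b refl)
skip-unskip zero    (suc y) _   = refl
skip-unskip (suc b) zero    _   = refl
skip-unskip (suc b) (suc y) y≢b = cong suc (skip-unskip b y (y≢b ∘ cong suc))

skip≢ : ∀ b x → skip b x ≢ b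
skip≢ (suc b) (suc x) eq = skip≢ b x (suc-injective eq)

skip-< : ∀ b x → x < b → skip b x ≡ x
skip-< (suc b) zero    _         = refl
skip-< (suc b) (suc x) (s≤s x<b) = cong suc (skip-< b x x<b)

skip-≥ : ∀ b x → b ≤ x → skip b x ≡ suc x
skip-≥ zero    x       _         = refl
skip-≥ (suc b) (suc x) (s≤s b≤x) = cong suc (skip-≥ b x b≤x)

skip-mono : ∀ b {x y} → x < y → skip b x < skip b y
skip-mono zero    x<y                       = s≤s x<y
skip-mono (suc b) {zero}  {suc y} _         = s≤s z≤n
skip-mono (suc b) {suc x} {suc y} (s≤s x<y) = s≤s (skip-mono b x<y)

skip-mono⁻ : ∀ b {x y} → skip b x < skip b y → x < y
skip-mono⁻ zero    (s≤s x<y)                = x<y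
skip-mono⁻ (suc b) {zero}  {suc y} _        = s≤s z≤n
skip-mono⁻ (suc b) {suc x} {suc y} (s≤s lt) = s≤s (skip-mono⁻ b lt)

skip-range : ∀ b m x → b ≤ m → x < m → skip b x < suc m
skip-range zero    m       x       _         x<m       = s≤s x<m
skip-range (suc b) (suc m) zero    _         _         = s≤s z≤n
skip-range (suc b) (suc m) (suc x) (s≤s b≤m) (s≤s x<m) = s≤s (skip-range b m x b≤m x<m)

skip>b : ∀ b x → b ≤ x → b < skip b x
skip>b b x b≤x = subst (b <_) (sym (skip-≥ b x b≤x)) (s≤s b≤x)

skip>b⁻ : ∀ b x → b < skip b x → b ≤ x
skip>b⁻ zero    x       _        = z≤n
skip>b⁻ (suc b) (suc x) (s≤s lt) = s≤s (skip>b⁻ b x lt)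

unskip-range : ∀ b m y → b ≤ m → y < suc m → y ≢ b → unskip b y < m
unskip-range b m y b≤m y<1+m y≢b =
  skip-mono⁻ b (subst (_< skip b m) (sym (skip-unskip b y y≢b)) (subst (y <_) (sym (skip-≥ b m b≤m)) y<1+m))

sh : ℕ → ℕ → ℕ
sh b x = suc (skip b x)

sh-mono : ∀ b {x y} → x < y → sh b x < sh b y
sh-mono b x<y = s≤s (skip-mono b x<y)

sh-mono⁻ : ∀ b {x y} → sh b x < sh b y → x < y
sh-mono⁻ b (s≤s lt) = skip-mono⁻ b lt

sh-injective : ∀ b {x y} → sh b x ≡ sh b y → x ≡ y
sh-injective b {x} {y} eq =
  trans (sym (unskip-skip b x)) (trans (cong (unskip b ∘ pred) eq) (unskip-skip b y))

sh≢arc : ∀ b x → sh b x ≢ suc b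
sh≢arc b x eq = skip≢ b x (suc-injective eq)

sh-range : ∀ b m x → b ≤ m → x < m → sh b x < 2 + m
sh-range b m x b≤m x<m = s≤s (skip-range b m x b≤m x<m)

sh>arc : ∀ b x → b ≤ x → suc b < sh b x
sh>arc b x b≤x = s≤s (skip>b b x b≤x)

sh>arc⁻ : ∀ b x → suc b < sh b x → b ≤ x
sh>arc⁻ b x (s≤s lt) = skip>b⁻ b x lt

insert : ℕ → (ℕ → ℕ) → ℕ → ℕ
insert b F zero    = suc b
insert b F (suc y) with y ≟ b
... | yes _ = 0
... | no _  = sh b (F (unskip b y))

insert-arc : ∀ b F → insert b F (suc b) ≡ 0
insert-arc b F with b ≟ b
... | yes _  = refl
... | no b≢b = ⊥-elim (b≢b refl)

insert-sh : ∀ b F x → insert b F (sh b x) ≡ sh b (F x)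
insert-sh b F x with skip b x ≟ b
... | yes eq = ⊥-elim (skip≢ b x eq)
... | no _   = cong (sh b ∘ F) (unskip-skip b x)

data Point (b m : ℕ) : ℕ → Set where
  origin : Point b m 0
  arc    : Point b m (suc b)
  old    : ∀ x → x < m → Point b m (sh b x)

point : ∀ b m i → b ≤ m → i < 2 + m → Point b m i
point b m zero    _   _         = origin
point b m (suc y) b≤m (s≤s y<1+m) with y ≟ b
... | yes refl = arc
... | no y≢b   = subst (Point b m) (cong suc (skip-unskip b y y≢b)) (old (unskip b y) (unskip-range b m y b≤m y<1+m y≢b))

Range : ℕ → (ℕ → ℕ) → Set
Range n f = ∀ i → i < n → f i < n

Involutive : ℕ → (ℕ → ℕ) → Set
Involutive n f = ∀ i → i < n → f (f i) ≡ i

Pattern123 : ℕ → (ℕ → ℕ) → Set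
Pattern123 n f = Σ ℕ λ i → Σ ℕ λ j → Σ ℕ λ k → (i < j × j < k × k < n) × (f i < f j × f j < f k)

Avoids123 : ℕ → (ℕ → ℕ) → Set
Avoids123 n f = ¬ Pattern123 n f

DecreasingFrom : ℕ → (ℕ → ℕ) → ℕ → Set
DecreasingFrom n f L = ∀ i j → L ≤ i → i < j → j < n → f j < f i

DecreasingSuffix : ℕ → (ℕ → ℕ) → ℕ → Set
DecreasingSuffix n f t = DecreasingFrom n f (n ∸ t)

LongestDecSuffix : ℕ → (ℕ → ℕ) → ℕ → Set
LongestDecSuffix n f d = d ≤ n × DecreasingSuffix n f d × (∀ t → t ≤ n → DecreasingSuffix n f t → t ≤ d)

shorter-suffix : ∀ n f d t → LongestDecSuffix n f d → t ≤ d → DecreasingSuffix n f t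
shorter-suffix n f d t (_ , dec , _) t≤d i j n∸t≤i = dec i j (≤-trans (∸-monoʳ-≤ n t≤d) n∸t≤i)

ascent : (ℕ → ℕ) → ℕ → ℕ → ℕ
ascent f i j = 𝟙 ((i <? j) ×-dec (f i <? f j))

ascent-none : ∀ f {i j} → ¬ (i < j × f i < f j) → ascent f i j ≡ 0
ascent-none f {i} {j} = 𝟙-no ((i <? j) ×-dec (f i <? f j))

ascent-cong : ∀ f g {i j i′ j′} → (i < j × f i < f j → i′ < j′ × g i′ < g j′) →
              (i′ < j′ × g i′ < g j′ → i < j × f i < f j) → ascent f i j ≡ ascent g i′ j′
ascent-cong f g {i} {j} {i′} {j′} = 𝟙-cong ((i <? j) ×-dec (f i <? f j)) ((i′ <? j′) ×-dec (g i′ <? g j′))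

coinvOn : ℕ → (ℕ → ℕ) → ℕ
coinvOn n f = Σ< n (λ i → Σ< n (ascent f i))

Σ-points : ∀ b m (φ : ℕ → ℕ) → b ≤ m → Σ< (2 + m) φ ≡ φ 0 + (φ (suc b) + Σ< m (φ ∘ sh b))
Σ-points b m φ b≤m = cong (φ 0 +_) (Σ-skip b m (φ ∘ suc) b≤m)
  where
  Σ-skip : ∀ b m (ψ : ℕ → ℕ) → b ≤ m → Σ< (suc m) ψ ≡ ψ b + Σ< m (ψ ∘ skip b)
  Σ-skip zero    m       ψ _         = refl
  Σ-skip (suc b) (suc m) ψ (s≤s b≤m) = begin
    ψ 0 + Σ< (suc m) (ψ ∘ suc)                 ≡⟨ cong (ψ 0 +_) (Σ-skip b m (ψ ∘ suc) b≤m) ⟩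
    ψ 0 + (ψ (suc b) + Σ< m (ψ ∘ suc ∘ skip b)) ≡⟨ sym (+-assoc (ψ 0) _ _) ⟩
    (ψ 0 + ψ (suc b)) + Σ< m (ψ ∘ suc ∘ skip b) ≡⟨ cong (_+ Σ< m (ψ ∘ suc ∘ skip b)) (+-comm (ψ 0) _) ⟩
    (ψ (suc b) + ψ 0) + Σ< m (ψ ∘ suc ∘ skip b) ≡⟨ +-assoc (ψ (suc b)) _ _ ⟩
    ψ (suc b) + Σ< (suc m) (ψ ∘ skip (suc b))   ∎
    where open ≡-Reasoning

count-beyond : ∀ b m → b ≤ m → Σ< m (λ y → 𝟙 (suc b <? sh b y)) ≡ m ∸ b
count-beyond b m b≤m = begin
  Σ< m beyond                                          ≡⟨ cong (λ l → Σ< l beyond) (sym (m+[n∸m]≡n b≤m)) ⟩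
  Σ< (b + (m ∸ b)) beyond                              ≡⟨ Σ-split b (m ∸ b) beyond ⟩
  Σ< b beyond + Σ< (m ∸ b) (λ y → beyond (b + y))      ≡⟨ cong₂ _+_ (Σ-zero b before) (Σ-cong (m ∸ b) after) ⟩
  0 + Σ< (m ∸ b) (λ _ → 1)                             ≡⟨ Σ-const1 (m ∸ b) ⟩
  m ∸ b                                                ∎
  where
  open ≡-Reasoning
  beyond = λ y → 𝟙 (suc b <? sh b y)
  before : ∀ y → y < b → beyond y ≡ 0
  before y y<b = 𝟙-no (suc b <? sh b y) (λ lt → <⇒≱ y<b (sh>arc⁻ b y lt))
  after : ∀ y → y < m ∸ b → beyond (b + y) ≡ 1
  after y _ = 𝟙-yes (suc b <? sh b (b + y)) (sh>arc b (b + y) (m≤m+n b y))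

module Insertion (m b : ℕ) (F : ℕ → ℕ) (b≤m : b ≤ m) where

  private
    G = insert b F

  insert-range : Range m F → Range (2 + m) G
  insert-range F<m i i<2+m with point b m i b≤m i<2+m
  ... | origin  = s≤s (s≤s b≤m)
  ... | arc     rewrite insert-arc b F = s≤s z≤n
  ... | old x x<m rewrite insert-sh b F x = sh-range b m (F x) b≤m (F<m x x<m)

  insert-involutive : Range m F → Involutive m F → Involutive (2 + m) G
  insert-involutive F<m FF≡ i i<2+m with point b m i b≤m i<2+m
  ... | origin  = insert-arc b F
  ... | arc     rewrite insert-arc b F = refl
  ... | old x x<m rewrite insert-sh b F x | insert-sh b F (F x) = cong (sh b) (FF≡ x x<m)

  insert-avoids : Range m F → Involutive m F → Avoids123 m F → DecreasingFrom m F b → Avoids123 (2 + m) G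
  insert-avoids F<m FF≡ avoids dec (i , j , k , (i<j , j<k , k<n) , (Gi<Gj , Gj<Gk)) =
    no-pattern (point b m i b≤m (<-trans i<j (<-trans j<k k<n))) (point b m j b≤m (<-trans j<k k<n))
               (point b m k b≤m k<n) i<j j<k Gi<Gj Gj<Gk
    where
    no-pattern : ∀ {i j k} → Point b m i → Point b m j → Point b m k → i < j → j < k → G i < G j → G j < G k → ⊥
    -- the value 0 at b + 1 cannot end an ascent
    no-pattern {i} _ arc _ _ _ Gi<Gj _ = n≮0 (subst (G i <_) (insert-arc b F) Gi<Gj)
    no-pattern {j = j} _ _ arc _ _ _ Gj<Gk = n≮0 (subst (G j <_) (insert-arc b F) Gj<Gk)
    -- b + 1 < F y < F z would give, applying the decreasing F, z < y
    no-pattern origin (old y y<m) (old z z<m) _ j<k Gi<Gj Gj<Gk rewrite insert-sh b F y | insert-sh b F z =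
      <-asym (sh-mono⁻ b j<k)
             (subst₂ _<_ (FF≡ z z<m) (FF≡ y y<m)
                     (dec (F y) (F z) (sh>arc⁻ b (F y) Gi<Gj) (sh-mono⁻ b Gj<Gk) (F<m z z<m)))
    -- b ≤ y < z with F y < F z contradicts monotonicity
    no-pattern arc (old y y<m) (old z z<m) i<j j<k _ Gj<Gk rewrite insert-sh b F y | insert-sh b F z =
      <-asym (sh-mono⁻ b Gj<Gk) (dec y z (sh>arc⁻ b y i<j) (sh-mono⁻ b j<k) z<m)
    -- three old points form a pattern of F
    no-pattern (old x x<m) (old y y<m) (old z z<m) i<j j<k Gi<Gj Gj<Gk
      rewrite insert-sh b F x | insert-sh b F y | insert-sh b F z =
      avoids (x , y , z , (sh-mono⁻ b i<j , sh-mono⁻ b j<k , z<m) , (sh-mono⁻ b Gi<Gj , sh-mono⁻ b Gj<Gk))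
    no-pattern _ origin _ () _ _ _
    no-pattern _ _ origin _ () _ _

  suffix-inner : b < m → DecreasingFrom m F b → LongestDecSuffix (2 + m) G (m ∸ b)
  suffix-inner b<m dec = ≤-trans (m∸n≤m m b) (m≤n+m m 2) , decreasing , longest
    where
    start : 2 + m ∸ (m ∸ b) ≡ 2 + b
    start = trans (+-∸-assoc 2 (m∸n≤m m b)) (cong (2 +_) (m∸[m∸n]≡n b≤m))
    decreasing : DecreasingSuffix (2 + m) G (m ∸ b)
    decreasing i j start≤i i<j j<n =
      go (point b m i b≤m (<-trans i<j j<n)) (point b m j b≤m j<n) (subst (_≤ i) start start≤i) i<j
      where
      go : ∀ {i j} → Point b m i → Point b m j → 2 + b ≤ i → i < j → G j < G i
      go arc           _             b+2≤i _   = ⊥-elim (<-irrefl refl b+2≤i)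
      go (old x x<m)   arc           b+2≤i i<j = ⊥-elim (<-irrefl refl (≤-trans b+2≤i (<⇒≤ i<j)))
      go (old x x<m)   (old y y<m)   b+2≤i i<j rewrite insert-sh b F x | insert-sh b F y =
        sh-mono b (dec x y (sh>arc⁻ b x b+2≤i) (sh-mono⁻ b i<j) y<m)
      go (old x x<m)   origin        _     ()
    -- a longer suffix would contain b + 1 (value 0) followed by sh b b
    longest : ∀ t → t ≤ 2 + m → DecreasingSuffix (2 + m) G t → t ≤ m ∸ b
    longest t _ dec′ with t ≤? m ∸ b
    ... | yes t≤ = t≤
    ... | no  t≰ = ⊥-elim (n≮0 (subst (G (sh b b) <_) (insert-arc b F)
                     (dec′ (suc b) (sh b b) start′ (sh>arc b b ≤-refl) (sh-range b m b b≤m b<m))))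
      where
      start′ : 2 + m ∸ t ≤ suc b
      start′ = ≤-trans (∸-monoʳ-≤ (2 + m) (≰⇒> t≰))
                       (≤-reflexive (trans (+-∸-assoc 1 (m∸n≤m m b)) (cong suc (m∸[m∸n]≡n b≤m))))

  -- Co-inversions of G: each row of the co-inversion sum either vanishes or
  -- reduces to a count over the old points.
  private
    row : ℕ → ℕ
    row i = Σ< (2 + m) (ascent G i)

    row-split : ∀ i → ascent G i 0 ≡ 0 → ascent G i (suc b) ≡ 0 → row i ≡ Σ< m (ascent G i ∘ sh b)
    row-split i at0 atArc = trans (Σ-points b m (ascent G i) b≤m) (cong₂ _+_ at0 (cong (_+ Σ< m (ascent G i ∘ sh b)) atArc))

    nothing-before-0 : ∀ i → ascent G i 0 ≡ 0
    nothing-before-0 i = ascent-none G {i} {0} (n≮0 ∘ proj₁)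

  row-origin : Range m F → Involutive m F → row 0 ≡ m ∸ b
  row-origin F<m FF≡ = begin
    row 0                                ≡⟨ row-split 0 (nothing-before-0 0) (ascent-none G below-0) ⟩
    Σ< m (ascent G 0 ∘ sh b)             ≡⟨ Σ-cong m (λ y _ → value-beyond y) ⟩
    Σ< m (λ y → 𝟙 (suc b <? sh b (F y))) ≡⟨ Σ-involution m F (λ y → 𝟙 (suc b <? sh b y)) F<m FF≡ ⟩
    Σ< m (λ y → 𝟙 (suc b <? sh b y))     ≡⟨ count-beyond b m b≤m ⟩
    m ∸ b                                ∎
    where
    open ≡-Reasoning
    below-0 : ¬ (0 < suc b × suc b < G (suc b))
    below-0 (_ , lt) = n≮0 (subst (suc b <_) (insert-arc b F) lt)
    value-beyond : ∀ y → ascent G 0 (sh b y) ≡ 𝟙 (suc b <? sh b (F y))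
    value-beyond y = 𝟙-cong ((0 <? sh b y) ×-dec (suc b <? G (sh b y))) (suc b <? sh b (F y))
      (λ (_ , lt) → subst (suc b <_) (insert-sh b F y) lt) (λ lt → s≤s z≤n , subst (suc b <_) (sym (insert-sh b F y)) lt)

  row-arc : row (suc b) ≡ m ∸ b
  row-arc = begin
    row (suc b)                      ≡⟨ row-split (suc b) (nothing-before-0 (suc b))
                                                  (ascent-none G {suc b} {suc b} (<-irrefl refl ∘ proj₁)) ⟩
    Σ< m (ascent G (suc b) ∘ sh b)   ≡⟨ Σ-cong m (λ y _ → position-beyond y) ⟩
    Σ< m (λ y → 𝟙 (suc b <? sh b y)) ≡⟨ count-beyond b m b≤m ⟩
    m ∸ b                            ∎
    where
    open ≡-Reasoning
    position-beyond : ∀ y → ascent G (suc b) (sh b y) ≡ 𝟙 (suc b <? sh b y)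
    position-beyond y = 𝟙-cong ((suc b <? sh b y) ×-dec (G (suc b) <? G (sh b y))) (suc b <? sh b y) proj₁
      (λ lt → lt , subst₂ _<_ (sym (insert-arc b F)) (sym (insert-sh b F y)) (s≤s z≤n))

  row-old : ∀ x → row (sh b x) ≡ Σ< m (ascent F x)
  row-old x = trans (row-split (sh b x) (nothing-before-0 (sh b x)) (ascent-none G value-0-last))
                    (Σ-cong m (λ y _ → ascent-cong G F (renamed⁻ y) (renamed⁺ y)))
    where
    value-0-last : ¬ (sh b x < suc b × G (sh b x) < G (suc b))
    value-0-last (_ , lt) = n≮0 (subst (G (sh b x) <_) (insert-arc b F) lt)
    renamed⁻ : ∀ y → sh b x < sh b y × G (sh b x) < G (sh b y) → x < y × F x < F y
    renamed⁻ y (x<y , Gx<Gy) = sh-mono⁻ b x<y , sh-mono⁻ b (subst₂ _<_ (insert-sh b F x) (insert-sh b F y) Gx<Gy)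
    renamed⁺ : ∀ y → x < y × F x < F y → sh b x < sh b y × G (sh b x) < G (sh b y)
    renamed⁺ y (x<y , Fx<Fy) = sh-mono b x<y , subst₂ _<_ (sym (insert-sh b F x)) (sym (insert-sh b F y)) (sh-mono b Fx<Fy)

  -- Hence the insertion adds 2(m - b) co-inversions: both 0 and b + 1 ascend
  -- to the m - b old points beyond b + 1, and the old points keep their order.
  insert-coinv : Range m F → Involutive m F → coinvOn (2 + m) G ≡ coinvOn m F + 2 * (m ∸ b)
  insert-coinv F<m FF≡ = begin
    Σ< (2 + m) row                            ≡⟨ Σ-points b m row b≤m ⟩
    row 0 + (row (suc b) + Σ< m (row ∘ sh b)) ≡⟨ cong₂ _+_ (row-origin F<m FF≡)
                                                           (cong₂ _+_ row-arc (Σ-cong m (λ x _ → row-old x))) ⟩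
    (m ∸ b) + ((m ∸ b) + coinvOn m F)         ≡⟨ sym (+-assoc (m ∸ b) (m ∸ b) _) ⟩
    ((m ∸ b) + (m ∸ b)) + coinvOn m F         ≡⟨ +-comm _ (coinvOn m F) ⟩
    coinvOn m F + ((m ∸ b) + (m ∸ b))         ≡⟨ cong (λ x → coinvOn m F + ((m ∸ b) + x)) (sym (+-identityʳ (m ∸ b))) ⟩
    coinvOn m F + 2 * (m ∸ b)                 ∎
    where open ≡-Reasoning

private
  suc∸≤ : ∀ m t → suc m ∸ t ≤ suc (m ∸ t)
  suc∸≤ m t = m≤n+o⇒m∸n≤o (suc m) t (subst (suc m ≤_) (sym (+-suc t (m ∸ t))) (s≤s (m≤n+m∸n m t)))

-- Inserting (0, m + 1) lengthens a longest decreasing suffix of length d < m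
-- by one: the new last point carries the value 0.
suffix-outer : ∀ m F d → LongestDecSuffix m F d → d < m → LongestDecSuffix (2 + m) (insert m F) (suc d)
suffix-outer m F d (d≤m , dec , longest) d<m = ≤-trans d<m (m≤n+m m 2) , decreasing , longest′
  where
  G = insert m F
  decreasing : DecreasingFrom (2 + m) G (suc m ∸ d)
  decreasing i j start≤i i<j j<n = go (point m m i ≤-refl (<-trans i<j j<n)) (point m m j ≤-refl j<n) start≤i i<j j<n
    where
    go : ∀ {i j} → Point m m i → Point m m j → suc m ∸ d ≤ i → i < j → j < 2 + m → G j < G i
    go origin      _           start≤0 _   _   = ⊥-elim (<⇒≱ (m<n⇒0<n∸m (s≤s d≤m)) start≤0)
    go arc         _           _       i<j j<n = ⊥-elim (<-irrefl refl (≤-trans j<n i<j))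
    go (old x x<m) arc         _       _   _   rewrite insert-arc m F | insert-sh m F x = s≤s z≤n
    go (old x x<m) (old y y<m) start≤i i<j _   rewrite insert-sh m F x | insert-sh m F y =
      sh-mono m (dec x y start′ (sh-mono⁻ m i<j) y<m)
      where
      start′ : m ∸ d ≤ x
      start′ = ≤-pred (subst₂ _≤_ (+-∸-assoc 1 d≤m) (cong suc (skip-< m x x<m)) start≤i)
    go (old x x<m) origin      _       ()  _
  restrict : ∀ t → DecreasingSuffix (2 + m) G (suc t) → DecreasingFrom m F (m ∸ t)
  restrict t dec′ x y start x<y y<m =
    sh-mono⁻ m (subst₂ _<_ (insert-sh m F y) (insert-sh m F x)
                 (dec′ (sh m x) (sh m y) start′ (sh-mono m x<y) (sh-range m m y ≤-refl y<m)))
    where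
    start′ : suc m ∸ t ≤ sh m x
    start′ = ≤-trans (suc∸≤ m t) (subst (suc (m ∸ t) ≤_) (cong suc (sym (skip-< m x (<-trans x<y y<m)))) (s≤s start))
  longest′ : ∀ t → t ≤ 2 + m → DecreasingSuffix (2 + m) G t → t ≤ suc d
  longest′ zero    _ _    = z≤n
  longest′ (suc t) _ dec′ with t ≤? m
  ... | yes t≤m = s≤s (longest t t≤m (restrict t dec′))
  ... | no  t≰m = ⊥-elim (<⇒≱ d<m (longest m ≤-refl (subst (DecreasingFrom m F) m∸t≡m∸m (restrict t dec′))))
    where
    m∸t≡m∸m : m ∸ t ≡ m ∸ m
    m∸t≡m∸m = trans (m≤n⇒m∸n≡0 (<⇒≤ (≰⇒> t≰m))) (sym (n∸n≡0 m))

suffix-outer-full : ∀ m F → Range m F → LongestDecSuffix m F m → LongestDecSuffix (2 + m) (insert m F) (2 + m)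
suffix-outer-full m F F<m (_ , dec , _) = ≤-refl , subst (DecreasingFrom (2 + m) G) (sym (n∸n≡0 (2 + m))) decreasing , λ t t≤ _ → t≤
  where
  G = insert m F
  dec₀ : DecreasingFrom m F 0
  dec₀ = subst (DecreasingFrom m F) (n∸n≡0 m) dec
  decreasing : DecreasingFrom (2 + m) G 0
  decreasing i j _ i<j j<n = go (point m m i ≤-refl (<-trans i<j j<n)) (point m m j ≤-refl j<n) i<j j<n
    where
    go : ∀ {i j} → Point m m i → Point m m j → i < j → j < 2 + m → G j < G i
    go origin      arc         _   _ rewrite insert-arc m F = s≤s z≤n
    go origin      (old y y<m) _   _ rewrite insert-sh m F y | skip-< m (F y) (F<m y y<m) = s≤s (F<m y y<m)
    go arc         _           i<j j<n = ⊥-elim (<-irrefl refl (≤-trans j<n i<j))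
    go (old x x<m) arc         _   _ rewrite insert-arc m F | insert-sh m F x = s≤s z≤n
    go (old x x<m) (old y y<m) i<j _ rewrite insert-sh m F x | insert-sh m F y =
      sh-mono m (dec₀ x y z≤n (sh-mono⁻ m i<j) y<m)
    go _           origin      ()  _

-- Conversely, a 123-avoiding involution G of [0, m + 2) with G 0 = b + 1 ≠ 0
-- arises by inserting (0, b + 1) into the involution F obtained by deleting
-- the points 0 and b + 1; F avoids 123 and is decreasing from position b on.
module Removal (m : ℕ) (G : ℕ → ℕ) (G<n : Range (2 + m) G) (GG≡ : Involutive (2 + m) G)
               (avoids : Avoids123 (2 + m) G) (G0≢0 : G 0 ≢ 0) where

  b : ℕ
  b = pred (G 0)

  G0≡ : G 0 ≡ suc b
  G0≡ = sym (suc-pred-≢0 (G 0) G0≢0)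
    where
    suc-pred-≢0 : ∀ n → n ≢ 0 → suc (pred n) ≡ n
    suc-pred-≢0 zero    n≢0 = ⊥-elim (n≢0 refl)
    suc-pred-≢0 (suc n) _   = refl

  b≤m : b ≤ m
  b≤m = ≤-pred (≤-pred (subst (_< 2 + m) G0≡ (G<n 0 (s≤s z≤n))))

  Garc≡0 : G (suc b) ≡ 0
  Garc≡0 = trans (cong G (sym G0≡)) (GG≡ 0 (s≤s z≤n))

  old-value : ∀ x → x < m → Σ ℕ λ y → G (sh b x) ≡ suc y × y ≢ b
  old-value x x<m with G (sh b x) in eq
  ... | zero  = ⊥-elim (sh≢arc b x (trans (sym (GG≡ (sh b x) (sh-range b m x b≤m x<m))) (trans (cong G eq) G0≡)))
  ... | suc y = y , refl , λ { refl → 1+n≢0 (trans (sym (GG≡ (sh b x) (sh-range b m x b≤m x<m))) (trans (cong G eq) Garc≡0)) }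

  F : ℕ → ℕ
  F x = unskip b (pred (G (sh b x)))

  G-old : ∀ x → x < m → G (sh b x) ≡ sh b (F x)
  G-old x x<m with old-value x x<m
  ... | y , eq , y≢b rewrite eq = cong suc (sym (skip-unskip b y y≢b))

  F-range : Range m F
  F-range x x<m with old-value x x<m | G<n (sh b x) (sh-range b m x b≤m x<m)
  ... | y , eq , y≢b | Gx<n rewrite eq = unskip-range b m y b≤m (≤-pred Gx<n) y≢b

  F-involutive : Involutive m F
  F-involutive x x<m = sh-injective b
    (trans (sym (G-old (F x) (F-range x x<m))) (trans (cong G (sym (G-old x x<m))) (GG≡ (sh b x) (sh-range b m x b≤m x<m))))

  F-avoids : Avoids123 m F
  F-avoids (x , y , z , (x<y , y<z , z<m) , (Fx<Fy , Fy<Fz)) =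
    avoids (sh b x , sh b y , sh b z , (sh-mono b x<y , sh-mono b y<z , sh-range b m z b≤m z<m) ,
            (subst₂ _<_ (sym (G-old x x<m)) (sym (G-old y y<m)) (sh-mono b Fx<Fy) ,
             subst₂ _<_ (sym (G-old y y<m)) (sym (G-old z z<m)) (sh-mono b Fy<Fz)))
    where
    y<m = <-trans y<z z<m
    x<m = <-trans x<y y<m

  -- an ascent F x < F y with b ≤ x < y would give the pattern (b + 1, sh b x, sh b y)
  F-decreasing : DecreasingFrom m F b
  F-decreasing x y b≤x x<y y<m with <-cmp (F y) (F x)
  ... | tri< Fy<Fx _ _ = Fy<Fx
  ... | tri≈ _ Fy≡Fx _ = ⊥-elim (<-irrefl (trans (sym (F-involutive x x<m)) (trans (cong F (sym Fy≡Fx)) (F-involutive y y<m))) x<y)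
    where x<m = <-trans x<y y<m
  ... | tri> _ _ Fx<Fy = ⊥-elim (avoids (suc b , sh b x , sh b y , (sh>arc b x b≤x , sh-mono b x<y , sh-range b m y b≤m y<m) ,
          (subst₂ _<_ (sym Garc≡0) (sym (G-old x x<m)) (s≤s z≤n) ,
           subst₂ _<_ (sym (G-old x x<m)) (sym (G-old y y<m)) (sh-mono b Fx<Fy))))
    where x<m = <-trans x<y y<m

  insert-removal : ∀ i → i < 2 + m → insert b F i ≡ G i
  insert-removal i i<n with point b m i b≤m i<n
  ... | origin    = sym G0≡
  ... | arc       = trans (insert-arc b F) (sym Garc≡0)
  ... | old x x<m = trans (insert-sh b F x) (sym (G-old x x<m))

insert-injective : ∀ m b b′ F F′ → b ≤ m → (∀ i → i < 2 + m → insert b F i ≡ insert b′ F′ i) →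
                   b ≡ b′ × (∀ x → x < m → F x ≡ F′ x)
insert-injective m b b′ F F′ b≤m agree with suc-injective (agree 0 (s≤s z≤n))
... | refl = refl , λ x x<m →
  sh-injective b (trans (sym (insert-sh b F x)) (trans (agree (sh b x) (sh-range b m x b≤m x<m)) (insert-sh b F′ x)))

decreasing-reverses : ∀ n (f : ℕ → ℕ) → (∀ i → 1 ≤ i → i < n → 1 ≤ f i × f i < n) →
                      (∀ i j → 1 ≤ i → i < j → j < n → f j < f i) →
                      ∀ i → 1 ≤ i → i < n → f i + i ≡ n
decreasing-reverses n f range dec i 1≤i i<n = ≤-antisym (upper i 1≤i i<n) (lower (n ∸ suc i) i 1≤i (m+[n∸m]≡n′))
  where
  m+[n∸m]≡n′ : i + suc (n ∸ suc i) ≡ n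
  m+[n∸m]≡n′ = trans (+-suc i _) (m+[n∸m]≡n i<n)
  -- f i + i can only decrease from i = 1 on, and starts below n
  upper : ∀ i → 1 ≤ i → i < n → f i + i ≤ n
  upper 1               _ 1<n = subst (_≤ n) (+-comm 1 (f 1)) (proj₂ (range 1 ≤-refl 1<n))
  upper (suc (suc i)) _ i<n = begin
    f (2 + i) + (2 + i) ≡⟨ +-suc (f (2 + i)) (suc i) ⟩
    suc (f (2 + i)) + suc i ≤⟨ +-monoˡ-≤ (suc i) (dec (suc i) (2 + i) (s≤s z≤n) ≤-refl i<n) ⟩
    f (suc i) + suc i   ≤⟨ upper (suc i) (s≤s z≤n) (<-trans ≤-refl i<n) ⟩
    n                   ∎
    where open ≤-Reasoning
  -- … and can only increase towards i = n - 1, where it is at least n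
  lower : ∀ r i → 1 ≤ i → i + suc r ≡ n → n ≤ f i + i
  lower zero    i 1≤i i+1≡n = subst (_≤ f i + i) (trans (+-comm 1 i) i+1≡n)
                                 (+-monoˡ-≤ i (proj₁ (range i 1≤i (subst (i <_) i+1≡n (≤-reflexive (+-comm 1 i))))))
  lower (suc r) i 1≤i i+r+2≡n = begin
    n                   ≤⟨ lower r (suc i) (s≤s z≤n) (trans (sym (+-suc i (suc r))) i+r+2≡n) ⟩
    f (suc i) + suc i   ≡⟨ +-suc (f (suc i)) i ⟩
    suc (f (suc i)) + i ≤⟨ +-monoˡ-≤ i (dec i (suc i) 1≤i ≤-refl 1+i<n) ⟩
    f i + i             ∎
    where
    open ≤-Reasoning
    1+i<n : suc i < n
    1+i<n = subst (suc i <_) i+r+2≡n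
              (≤-trans (s≤s (s≤s (m≤m+n i r))) (≤-reflexive (sym (trans (+-suc i (suc r)) (cong suc (+-suc i r))))))

headFixed : ℕ → ℕ → ℕ
headFixed n zero    = 0
headFixed n (suc x) = n ∸ suc x

headFixed-range : ∀ n → Range n (headFixed n)
headFixed-range n zero    0<n   = 0<n
headFixed-range n (suc x) 1+x<n = ∸-monoʳ-< {o = 0} (s≤s z≤n) (<⇒≤ 1+x<n)

headFixed-involutive : ∀ n → Involutive n (headFixed n)
headFixed-involutive n zero    _     = refl
headFixed-involutive n (suc x) 1+x<n with n ∸ suc x in eq
... | zero  = ⊥-elim (<⇒≢ (m<n⇒0<n∸m 1+x<n) (sym eq))
... | suc _ = trans (cong (n ∸_) (sym eq)) (m∸[m∸n]≡n (<⇒≤ 1+x<n))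

headFixed-avoids : ∀ n → Avoids123 n (headFixed n)
headFixed-avoids n (i , suc j , suc k , (_ , j<k , k<n) , (_ , fj<fk)) = <-asym fj<fk (∸-monoʳ-< j<k (<⇒≤ k<n))

-- It is the only 123-avoiding involution fixing 0: every later point must lie
-- below 0 in a decreasing run.
headFixed-unique : ∀ n (G : ℕ → ℕ) → Range n G → Involutive n G → Avoids123 n G → G 0 ≡ 0 →
                   ∀ i → i < n → G i ≡ headFixed n i
headFixed-unique n G G<n GG≡ avoids G0≡0 zero    _     = G0≡0
headFixed-unique n G G<n GG≡ avoids G0≡0 (suc x) 1+x<n =
  trans (sym (m+n∸n≡m (G (suc x)) (suc x))) (cong (_∸ suc x) (decreasing-reverses n G range dec (suc x) (s≤s z≤n) 1+x<n))
  where
  nonzero : ∀ i → 1 ≤ i → i < n → G i ≢ 0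
  nonzero i 1≤i i<n Gi≡0 = <⇒≢ 1≤i (sym (trans (sym (GG≡ i i<n)) (trans (cong G Gi≡0) G0≡0)))
  range : ∀ i → 1 ≤ i → i < n → 1 ≤ G i × G i < n
  range i 1≤i i<n = n≢0⇒n>0 (nonzero i 1≤i i<n) , G<n i i<n
  dec : ∀ i j → 1 ≤ i → i < j → j < n → G j < G i
  dec i j 1≤i i<j j<n with <-cmp (G j) (G i)
  ... | tri< Gj<Gi _ _ = Gj<Gi
  ... | tri≈ _ Gj≡Gi _ = ⊥-elim (<-irrefl (trans (sym (GG≡ i (<-trans i<j j<n))) (trans (cong G (sym Gj≡Gi)) (GG≡ j j<n))) i<j)
  ... | tri> _ _ Gi<Gj = ⊥-elim (avoids (0 , i , j , (1≤i , i<j , j<n) ,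
                                  (subst (_< G i) (sym G0≡0) (n≢0⇒n>0 (nonzero i 1≤i (<-trans i<j j<n))) , Gi<Gj)))

headFixed-suffix : ∀ m → LongestDecSuffix (2 + m) (headFixed (2 + m)) (suc m)
headFixed-suffix m = n≤1+n (suc m) , subst (DecreasingFrom (2 + m) f) (sym (suc∸self (suc m))) from1 , longest
  where
  f = headFixed (2 + m)
  suc∸self : ∀ k → suc k ∸ k ≡ 1
  suc∸self zero    = refl
  suc∸self (suc k) = suc∸self k
  from1 : DecreasingFrom (2 + m) f 1
  from1 (suc i) (suc j) _ i<j j<n = ∸-monoʳ-< i<j (<⇒≤ j<n)
  longest : ∀ t → t ≤ 2 + m → DecreasingSuffix (2 + m) f t → t ≤ suc m
  longest t _ dec with t ≤? suc m
  ... | yes t≤ = t≤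
  ... | no  t≰ = ⊥-elim (n≮0 (dec 0 1 (≤-reflexive (m≤n⇒m∸n≡0 (≰⇒> t≰))) (s≤s z≤n) (s≤s (s≤s z≤n))))

headFixed-suffix₁ : LongestDecSuffix 1 (headFixed 1) 1
headFixed-suffix₁ = ≤-refl , (λ { i (suc j) _ _ (s≤s ()) }) , λ t t≤1 _ → t≤1

-- The involution fixing 0 and reversing the rest has exactly the n - 1 ascents (0, j).
coinv-headFixed : ∀ m → coinvOn (suc m) (headFixed (suc m)) ≡ m
coinv-headFixed m = begin
  Σ< (suc m) (ascent f 0) + Σ< m (λ x → Σ< (suc m) (ascent f (suc x)))
    ≡⟨ cong₂ _+_ row-origin (Σ-zero m (λ x _ → Σ-zero (suc m) (later x))) ⟩
  m + 0 ≡⟨ +-identityʳ m ⟩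
  m     ∎
  where
  open ≡-Reasoning
  f = headFixed (suc m)
  row-origin : Σ< (suc m) (ascent f 0) ≡ m
  row-origin = trans (cong (_+ Σ< m (ascent f 0 ∘ suc)) (ascent-none f {0} {0} (<-irrefl refl ∘ proj₁)))
                     (trans (Σ-cong m (λ y y<m → 𝟙-yes ((0 <? suc y) ×-dec (0 <? f (suc y))) (s≤s z≤n , m<n⇒0<n∸m (s≤s y<m))))
                            (Σ-const1 m))
  later : ∀ x j → j < suc m → ascent f (suc x) j ≡ 0
  later x zero    _       = ascent-none f {suc x} {0} (n≮0 ∘ proj₁)
  later x (suc y) 1+y<1+m = ascent-none f (λ (x<y , fx<fy) → <-asym fx<fy (∸-monoʳ-< x<y (<⇒≤ 1+y<1+m)))

-- Vectors of Fin n, read as functions ℕ → ℕ (0 beyond their length), and back.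

fun : ∀ {n m} → Vec (Fin n) m → ℕ → ℕ
fun []      i       = 0
fun (x ∷ v) zero    = toℕ x
fun (x ∷ v) (suc i) = fun v i

fun-lookup : ∀ {n m} (v : Vec (Fin n) m) (p : Fin m) → fun v (toℕ p) ≡ toℕ (lookup v p)
fun-lookup (x ∷ v) Fin.zero    = refl
fun-lookup (x ∷ v) (Fin.suc p) = fun-lookup v p

fun-at : ∀ {n m} (v : Vec (Fin n) m) i (i<m : i < m) → fun v i ≡ toℕ (lookup v (fromℕ< i<m))
fun-at v i i<m = trans (cong (fun v) (sym (toℕ-fromℕ< i<m))) (fun-lookup v (fromℕ< i<m))

fun-range : ∀ {n m} (v : Vec (Fin n) m) → ∀ i → i < m → fun v i < n
fun-range (x ∷ v) zero    _         = toℕ<n x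
fun-range (x ∷ v) (suc i) (s≤s i<m) = fun-range v i i<m

_≈[_]_ : (ℕ → ℕ) → ℕ → (ℕ → ℕ) → Set
f ≈[ n ] g = ∀ i → i < n → f i ≡ g i

fun-injective : ∀ {n m} (σ τ : Vec (Fin n) m) → fun σ ≈[ m ] fun τ → σ ≡ τ
fun-injective []      []      _     = refl
fun-injective (x ∷ σ) (y ∷ τ) agree =
  cong₂ _∷_ (toℕ-injective (agree 0 (s≤s z≤n))) (fun-injective σ τ (λ i i<m → agree (suc i) (s≤s i<m)))

vec : ∀ n (f : ℕ → ℕ) → Range n f → Vec (Fin n) n
vec n f f<n = tabulate (λ p → fromℕ< (f<n (toℕ p) (toℕ<n p)))

fun-vec : ∀ n f (f<n : Range n f) → fun (vec n f f<n) ≈[ n ] f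
fun-vec n f f<n i i<n = begin
  fun (vec n f f<n) i                                ≡⟨ fun-at (vec n f f<n) i i<n ⟩
  toℕ (lookup (vec n f f<n) (fromℕ< i<n))            ≡⟨ cong toℕ (lookup∘tabulate _ (fromℕ< i<n)) ⟩
  toℕ (fromℕ< (f<n (toℕ (fromℕ< i<n)) (toℕ<n (fromℕ< i<n)))) ≡⟨ toℕ-fromℕ< _ ⟩
  f (toℕ (fromℕ< i<n))                               ≡⟨ cong f (toℕ-fromℕ< i<n) ⟩
  f i                                                ∎
  where open ≡-Reasoning

involution⇒ : ∀ {n} (σ : Vec (Fin n) n) → IsInvolution σ → Involutive n (fun σ)
involution⇒ σ inv i i<n = begin
  fun σ (fun σ i)                                      ≡⟨ cong (fun σ) (fun-at σ i i<n) ⟩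
  fun σ (toℕ (lookup σ (fromℕ< i<n)))                  ≡⟨ fun-lookup σ (lookup σ (fromℕ< i<n)) ⟩
  toℕ (lookup σ (lookup σ (fromℕ< i<n)))               ≡⟨ cong toℕ (inv (fromℕ< i<n)) ⟩
  toℕ (fromℕ< i<n)                                     ≡⟨ toℕ-fromℕ< i<n ⟩
  i                                                    ∎
  where open ≡-Reasoning

involution⇐ : ∀ {n} (σ : Vec (Fin n) n) → Involutive n (fun σ) → IsInvolution σ
involution⇐ σ inv p = toℕ-injective
  (trans (sym (fun-lookup σ (lookup σ p))) (trans (cong (fun σ) (sym (fun-lookup σ p))) (inv (toℕ p) (toℕ<n p))))

contains⇒ : ∀ {n} (σ : Vec (Fin n) n) → Contains123 σ → Pattern123 n (fun σ)
contains⇒ σ (i , j , k , (i<j , j<k) , (σi<σj , σj<σk)) =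
  toℕ i , toℕ j , toℕ k , (i<j , j<k , toℕ<n k) ,
  (subst₂ _<_ (sym (fun-lookup σ i)) (sym (fun-lookup σ j)) σi<σj ,
   subst₂ _<_ (sym (fun-lookup σ j)) (sym (fun-lookup σ k)) σj<σk)

contains⇐ : ∀ {n} (σ : Vec (Fin n) n) → Pattern123 n (fun σ) → Contains123 σ
contains⇐ σ (i , j , k , (i<j , j<k , k<n) , (σi<σj , σj<σk)) =
  fromℕ< i<n , fromℕ< j<n , fromℕ< k<n ,
  (subst₂ _<_ (sym (toℕ-fromℕ< i<n)) (sym (toℕ-fromℕ< j<n)) i<j ,
   subst₂ _<_ (sym (toℕ-fromℕ< j<n)) (sym (toℕ-fromℕ< k<n)) j<k) ,
  (subst₂ _<_ (fun-at σ i i<n) (fun-at σ j j<n) σi<σj , subst₂ _<_ (fun-at σ j j<n) (fun-at σ k k<n) σj<σk)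
  where
  j<n = <-trans j<k k<n
  i<n = <-trans i<j j<n

coinv≡coinvOn : ∀ {n} (σ : Vec (Fin n) n) → coinv σ ≡ coinvOn n (fun σ)
coinv≡coinvOn {n} σ = begin
  coinv σ
    ≡⟨ count-concatMap ascent? (λ i → map (i ,_) (allFin n)) (allFin n) ⟩
  sum (map (λ i → count ascent? (map (i ,_) (allFin n))) (allFin n))
    ≡⟨ sum-allFin n _ _ (λ i → trans (count-map ascent? (i ,_) (allFin n))
                                (trans (count≡sum𝟙 _ (allFin n)) (sum-allFin n _ _ (λ j → same-ascent i j)))) ⟩
  coinvOn n (fun σ) ∎
  where
  open ≡-Reasoning
  ascent? : Decidable (λ (p : Fin n × Fin n) → (proj₁ p Fin.< proj₂ p) × (lookup σ (proj₁ p) Fin.< lookup σ (proj₂ p)))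
  ascent? (i , j) = (i Fin.<? j) ×-dec (lookup σ i Fin.<? lookup σ j)
  same-ascent : ∀ i j → 𝟙 (ascent? (i , j)) ≡ ascent (fun σ) (toℕ i) (toℕ j)
  same-ascent i j rewrite fun-lookup σ i | fun-lookup σ j = refl

involutive-≈ : ∀ n f g → f ≈[ n ] g → Range n f → Involutive n f → Involutive n g
involutive-≈ n f g f≈g f<n ff≡ i i<n = trans (cong g (sym (f≈g i i<n))) (trans (sym (f≈g (f i) (f<n i i<n))) (ff≡ i i<n))

avoids-≈ : ∀ n f g → f ≈[ n ] g → Avoids123 n f → Avoids123 n g
avoids-≈ n f g f≈g avoids (i , j , k , (i<j , j<k , k<n) , (gi<gj , gj<gk)) =
  avoids (i , j , k , (i<j , j<k , k<n) ,
          (subst₂ _<_ (sym (f≈g i i<n)) (sym (f≈g j j<n)) gi<gj , subst₂ _<_ (sym (f≈g j j<n)) (sym (f≈g k k<n)) gj<gk))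
  where
  j<n = <-trans j<k k<n
  i<n = <-trans i<j j<n

decreasingFrom-≈ : ∀ n f g L → f ≈[ n ] g → DecreasingFrom n f L → DecreasingFrom n g L
decreasingFrom-≈ n f g L f≈g dec i j L≤i i<j j<n = subst₂ _<_ (f≈g j j<n) (f≈g i (<-trans i<j j<n)) (dec i j L≤i i<j j<n)

longestDecSuffix-≈ : ∀ n f g d → f ≈[ n ] g → LongestDecSuffix n f d → LongestDecSuffix n g d
longestDecSuffix-≈ n f g d f≈g (d≤n , dec , longest) =
  d≤n , decreasingFrom-≈ n f g _ f≈g dec ,
  λ t t≤n dec′ → longest t t≤n (decreasingFrom-≈ n g f _ (λ i i<n → sym (f≈g i i<n)) dec′)

coinvOn-≈ : ∀ n f g → f ≈[ n ] g → coinvOn n f ≡ coinvOn n g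
coinvOn-≈ n f g f≈g = Σ-cong n (λ i i<n → Σ-cong n (λ j j<n →
  ascent-cong f g (λ (i<j , lt) → i<j , subst₂ _<_ (f≈g i i<n) (f≈g j j<n) lt)
                  (λ (i<j , lt) → i<j , subst₂ _<_ (sym (f≈g i i<n)) (sym (f≈g j j<n)) lt)))

insert-≈ : ∀ m b F F′ → b ≤ m → F ≈[ m ] F′ → insert b F ≈[ 2 + m ] insert b F′
insert-≈ m b F F′ b≤m F≈F′ i i<n with point b m i b≤m i<n
... | origin    = refl
... | arc       = trans (insert-arc b F) (sym (insert-arc b F′))
... | old x x<m = trans (insert-sh b F x) (trans (cong (sh b) (F≈F′ x x<m)) (sym (insert-sh b F′ x)))

decreasingFrom? : ∀ n f L → Dec (DecreasingFrom n f L)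
decreasingFrom? n f L =
  map′ (λ dec i j L≤i i<j j<n → dec j<n i<j L≤i) (λ dec {j} j<n {i} i<j L≤i → dec i j L≤i i<j j<n)
       (allUpTo? (λ j → allUpTo? (λ i → (L ≤? i) →-dec (f j <? f i)) j) n)

-- Growing a 123-avoiding involution τ of [0, m) by one 2-cycle: grow τ t
-- inserts (0, m - t + 1), so that t old points follow the new one.
grow-range : ∀ {m} (τ : Vec (Fin m) m) t → Range (2 + m) (insert (m ∸ t) (fun τ))
grow-range {m} τ t = Insertion.insert-range m (m ∸ t) (fun τ) (m∸n≤m m t) (fun-range τ)

grow : ∀ {m} → Vec (Fin m) m → ℕ → Vec (Fin (2 + m)) (2 + m)
grow {m} τ t = vec (2 + m) (insert (m ∸ t) (fun τ)) (grow-range τ t)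

fun-grow : ∀ {m} (τ : Vec (Fin m) m) t → fun (grow τ t) ≈[ 2 + m ] insert (m ∸ t) (fun τ)
fun-grow {m} τ t = fun-vec (2 + m) (insert (m ∸ t) (fun τ)) (grow-range τ t)

-- Reach ℓ τ σ: σ arises from τ by ℓ growth steps, each inserting in front of
-- a decreasing suffix (which keeps the involution 123-avoiding).
Reach : ℕ → ∀ {m} → Vec (Fin m) m → ∀ {N} → Vec (Fin N) N → Set
Reach zero    {m} τ {N} σ = (m ≡ N) × (fun τ ≈[ m ] fun σ)
Reach (suc ℓ) {m} τ     σ = ∃ λ t → t < suc m × (DecreasingSuffix m (fun τ) t × Reach ℓ (grow τ t) σ)

reach? : ∀ ℓ {m} (τ : Vec (Fin m) m) {N} (σ : Vec (Fin N) N) → Dec (Reach ℓ τ σ)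
reach? zero    {m} τ {N} σ = (m ≟ N) ×-dec map′ (λ agree i i<m → agree i<m) (λ agree {i} → agree i)
                                                (allUpTo? (λ i → fun τ i ≟ fun σ i) m)
reach? (suc ℓ) {m} τ     σ = anyUpTo? (λ t → decreasingFrom? m (fun τ) (m ∸ t) ×-dec reach? ℓ (grow τ t) σ) (suc m)

reach-start : ∀ ℓ {m} (ρ ρ′ : Vec (Fin m) m) {N} (σ : Vec (Fin N) N) → Reach ℓ ρ σ → Reach ℓ ρ′ σ → fun ρ ≈[ m ] fun ρ′
reach-start zero    ρ ρ′ σ (_ , ρ≈σ) (_ , ρ′≈σ) i i<m = trans (ρ≈σ i i<m) (sym (ρ′≈σ i i<m))
reach-start (suc ℓ) {m} ρ ρ′ σ (t , _ , _ , r) (t′ , _ , _ , r′) =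
  proj₂ (insert-injective m (m ∸ t) (m ∸ t′) (fun ρ) (fun ρ′) (m∸n≤m m t)
          (λ i i<n → trans (sym (fun-grow ρ t i i<n))
                           (trans (reach-start ℓ (grow ρ t) (grow ρ′ t′) σ r r′ i i<n) (fun-grow ρ′ t′ i i<n))))

reach-first-step : ∀ ℓ {m} (ρ : Vec (Fin m) m) {N} (σ : Vec (Fin N) N) t t′ → t ≤ m → t′ ≤ m →
                   Reach ℓ (grow ρ t) σ → Reach ℓ (grow ρ t′) σ → t ≡ t′
reach-first-step ℓ {m} ρ σ t t′ t≤m t′≤m r r′ =
  ∸-cancelˡ-≡ t≤m t′≤m (proj₁ (insert-injective m (m ∸ t) (m ∸ t′) (fun ρ) (fun ρ) (m∸n≤m m t)
    (λ i i<n → trans (sym (fun-grow ρ t i i<n)) (trans (reach-start ℓ (grow ρ t) (grow ρ t′) σ r r′ i i<n) (fun-grow ρ t′ i i<n)))))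

record Admissible (m : ℕ) (τ : Vec (Fin m) m) (d : ℕ) : Set where
  field
    involutive : Involutive m (fun τ)
    avoids     : Avoids123 m (fun τ)
    suffix     : LongestDecSuffix m (fun τ) d

-- The suffix length after inserting (0, m + 1): one more, or everything once
-- the whole involution is decreasing.
nextSuffix : ℕ → ℕ → ℕ
nextSuffix zero    zero    = 2
nextSuffix zero    (suc m) = 1
nextSuffix (suc d) zero    = 2
nextSuffix (suc d) (suc m) = suc (nextSuffix d m)

nextSuffix-< : ∀ d m → d < m → nextSuffix d m ≡ suc d
nextSuffix-< zero    (suc m) _         = refl
nextSuffix-< (suc d) (suc m) (s≤s d<m) = cong suc (nextSuffix-< d m d<m)

nextSuffix-≥ : ∀ d m → m ≤ d → nextSuffix d m ≡ 2 + m
nextSuffix-≥ zero    zero    _         = refl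
nextSuffix-≥ (suc d) zero    _         = refl
nextSuffix-≥ (suc d) (suc m) (s≤s m≤d) = cong suc (nextSuffix-≥ d m m≤d)

grow-outer : ∀ {m} (τ : Vec (Fin m) m) d → Admissible m τ d → Admissible (2 + m) (grow τ 0) (nextSuffix d m)
grow-outer {m} τ d adm = record
  { involutive = involutive-≈ (2 + m) G (fun (grow τ 0)) G≈ (insert-range (fun-range τ)) (insert-involutive (fun-range τ) involutive)
  ; avoids     = avoids-≈ (2 + m) G (fun (grow τ 0)) G≈ (insert-avoids (fun-range τ) involutive avoids nothing-after-m)
  ; suffix     = longestDecSuffix-≈ (2 + m) G (fun (grow τ 0)) (nextSuffix d m) G≈ new-suffix
  }
  where
  open Admissible adm
  open Insertion m m (fun τ) ≤-refl
  G = insert m (fun τ)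
  G≈ : G ≈[ 2 + m ] fun (grow τ 0)
  G≈ i i<n = sym (fun-grow τ 0 i i<n)
  nothing-after-m : DecreasingFrom m (fun τ) m
  nothing-after-m i j m≤i i<j j<m = ⊥-elim (<-irrefl refl (≤-trans j<m (≤-trans m≤i (<⇒≤ i<j))))
  new-suffix : LongestDecSuffix (2 + m) G (nextSuffix d m)
  new-suffix with d <? m
  ... | yes d<m = subst (LongestDecSuffix (2 + m) G) (sym (nextSuffix-< d m d<m)) (suffix-outer m (fun τ) d suffix d<m)
  ... | no  d≮m = subst (LongestDecSuffix (2 + m) G) (sym (nextSuffix-≥ d m (≮⇒≥ d≮m)))
                    (suffix-outer-full m (fun τ) (fun-range τ)
                       (subst (LongestDecSuffix m (fun τ)) (≤-antisym (proj₁ suffix) (≮⇒≥ d≮m)) suffix))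

grow-inner : ∀ {m} (τ : Vec (Fin m) m) d t → t < d → Admissible m τ d → Admissible (2 + m) (grow τ (suc t)) (suc t)
grow-inner {m} τ d t t<d adm = record
  { involutive = involutive-≈ (2 + m) G (fun (grow τ (suc t))) G≈ (insert-range (fun-range τ)) (insert-involutive (fun-range τ) involutive)
  ; avoids     = avoids-≈ (2 + m) G (fun (grow τ (suc t))) G≈ (insert-avoids (fun-range τ) involutive avoids dec)
  ; suffix     = longestDecSuffix-≈ (2 + m) G (fun (grow τ (suc t))) (suc t) G≈
                   (subst (LongestDecSuffix (2 + m) G) (m∸[m∸n]≡n 1+t≤m) (suffix-inner b<m dec))
  }
  where
  open Admissible adm
  1+t≤m : suc t ≤ m
  1+t≤m = ≤-trans t<d (proj₁ suffix)
  b = m ∸ suc t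
  b<m : b < m
  b<m = ∸-monoʳ-< {o = 0} (s≤s z≤n) 1+t≤m
  open Insertion m b (fun τ) (m∸n≤m m (suc t))
  G = insert b (fun τ)
  G≈ : G ≈[ 2 + m ] fun (grow τ (suc t))
  G≈ i i<n = sym (fun-grow τ (suc t) i i<n)
  dec : DecreasingFrom m (fun τ) b
  dec = shorter-suffix m (fun τ) d (suc t) suffix t<d

coinv-grow : ∀ {m} (τ : Vec (Fin m) m) t → t ≤ m → Involutive m (fun τ) → coinv (grow τ t) ≡ coinv τ + 2 * t
coinv-grow {m} τ t t≤m involutive = begin
  coinv (grow τ t)                             ≡⟨ coinv≡coinvOn (grow τ t) ⟩
  coinvOn (2 + m) (fun (grow τ t))             ≡⟨ coinvOn-≈ (2 + m) _ _ (fun-grow τ t) ⟩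
  coinvOn (2 + m) (insert (m ∸ t) (fun τ))     ≡⟨ Insertion.insert-coinv m (m ∸ t) (fun τ) (m∸n≤m m t) (fun-range τ) involutive ⟩
  coinvOn m (fun τ) + 2 * (m ∸ (m ∸ t))        ≡⟨ cong₂ (λ c s → c + 2 * s) (sym (coinv≡coinvOn τ)) (m∸[m∸n]≡n t≤m) ⟩
  coinv τ + 2 * t                              ∎
  where open ≡-Reasoning

_≟ᵥ_ : ∀ {m n} (v w : Vec (Fin m) n) → Dec (v ≡ w)
_≟ᵥ_ = ≡-dec Fin._≟_

allVecs-once : ∀ m n (v : Vec (Fin m) n) → count (_≟ᵥ v) (allVecs m n) ≡ 1
allVecs-once m zero    []      = refl
allVecs-once m (suc n) (y ∷ v) = begin
  count (_≟ᵥ (y ∷ v)) (allVecs m (suc n))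
    ≡⟨ count-concatMap (_≟ᵥ (y ∷ v)) (λ x → map (x ∷_) (allVecs m n)) (allFin m) ⟩
  sum (map (λ x → count (_≟ᵥ (y ∷ v)) (map (x ∷_) (allVecs m n))) (allFin m))
    ≡⟨ sum-allFin m _ (λ i → 𝟙 (toℕ y ≟ i) * 1) (λ x → trans (count-map (_≟ᵥ (y ∷ v)) (x ∷_) (allVecs m n)) (head-once x)) ⟩
  Σ< m (λ i → 𝟙 (toℕ y ≟ i) * 1)
    ≡⟨ Σ-pick m (toℕ y) (λ _ → 1) (toℕ<n y) ⟩
  1 ∎
  where
  open ≡-Reasoning
  head-once : ∀ x → count (λ w → (x ∷ w) ≟ᵥ (y ∷ v)) (allVecs m n) ≡ 𝟙 (toℕ y ≟ toℕ x) * 1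
  head-once x with x Fin.≟ y
  ... | yes refl = trans (count-cong _ (_≟ᵥ v) (allVecs m n) (λ w → proj₂ ∘ ∷-injective) (λ w → cong (x ∷_)))
                         (trans (allVecs-once m n v) (sym (cong (_* 1) (𝟙-yes (toℕ x ≟ toℕ x) refl))))
  ... | no x≢y   = trans (count-none _ (allVecs m n) (λ w → x≢y ∘ proj₁ ∘ ∷-injective))
                         (sym (cong (_* 1) (𝟙-no (toℕ y ≟ toℕ x) (x≢y ∘ sym ∘ toℕ-injective))))

Good : ∀ {n} → Vec (Fin n) n → Set
Good σ = IsInvolution σ × ¬ Contains123 σ

good? : ∀ {n} → Decidable (Good {n})
good? σ = isInvolution? σ ×-dec ¬? (contains123? σ)

good⇐ : ∀ {n} (σ : Vec (Fin n) n) → Involutive n (fun σ) → Avoids123 n (fun σ) → Good σ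
good⇐ σ involutive avoids = involution⇐ σ involutive , avoids ∘ contains⇒ σ

Ends : ℕ → ∀ {m} → Vec (Fin m) m → ℕ → ∀ {N} → Vec (Fin N) N → Set
Ends ℓ τ c σ = (Good σ × Reach ℓ τ σ) × coinv σ ≡ c

ends? : ∀ ℓ {m} (τ : Vec (Fin m) m) c {N} → Decidable (Ends ℓ τ c {N})
ends? ℓ τ c σ = (good? σ ×-dec reach? ℓ τ σ) ×-dec (coinv σ ≟ c)

reachCount : ℕ → ∀ {m} → Vec (Fin m) m → ℕ → ℕ → ℕ
reachCount ℓ τ N c = count (ends? ℓ τ c {N}) (allVecs N N)

-- The generating-tree recursion: growCoeff d m ℓ e c is the number of growth
-- histories of length ℓ, starting from an admissible involution of [0, m) with
-- suffix length d and co-inversion number e, that end at co-inversion number c.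
growCoeff : ℕ → ℕ → ℕ → ℕ → ℕ → ℕ
growCoeff d m zero    e c = 𝟙 (e ≟ c)
growCoeff d m (suc ℓ) e c =
  growCoeff (nextSuffix d m) (2 + m) ℓ e c + Σ< d (λ t → growCoeff (suc t) (2 + m) ℓ (e + 2 * suc t) c)

two-more : ∀ m ℓ → m + 2 * suc ℓ ≡ 2 + m + 2 * ℓ
two-more m ℓ = trans (cong (m +_) (*-distribˡ-+ 2 1 ℓ)) (trans (sym (+-assoc m 2 (2 * ℓ))) (cong (_+ 2 * ℓ) (+-comm m 2)))

count-histories₀ : ∀ {m} (τ : Vec (Fin m) m) c → Good τ → reachCount 0 τ m c ≡ 𝟙 (coinv τ ≟ c)
count-histories₀ {m} τ c good = by-cases (coinv τ ≟ c)
  where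
  is-τ : ∀ σ → fun τ ≈[ m ] fun σ → σ ≡ τ
  is-τ σ agree = fun-injective σ τ (λ i i<m → sym (agree i i<m))
  by-cases : Dec (coinv τ ≡ c) → reachCount 0 τ m c ≡ 𝟙 (coinv τ ≟ c)
  by-cases (yes τ↦c) =
    trans (count-cong _ (_≟ᵥ τ) (allVecs m m) (λ σ ((_ , _ , agree) , _) → is-τ σ agree)
                      (λ { σ refl → (good , refl , λ _ _ → refl) , τ↦c }))
          (trans (allVecs-once m m τ) (sym (𝟙-yes (coinv τ ≟ c) τ↦c)))
  by-cases (no ¬τ↦c) =
    trans (count-none _ (allVecs m m) (λ σ ((_ , _ , agree) , σ↦c) → ¬τ↦c (subst (λ ρ → coinv ρ ≡ c) (is-τ σ agree) σ↦c)))
          (sym (𝟙-no (coinv τ ≟ c) ¬τ↦c))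

count-histories : ∀ ℓ {m} (τ : Vec (Fin m) m) N d c → Admissible m τ d → m + 2 * ℓ ≡ N →
                  reachCount ℓ τ N c ≡ growCoeff d m ℓ (coinv τ) c
count-histories zero {m} τ N d c adm m+0≡N with trans (sym (+-identityʳ m)) m+0≡N
... | refl = count-histories₀ τ c (good⇐ τ (Admissible.involutive adm) (Admissible.avoids adm))
count-histories (suc ℓ) {m} τ N d c adm size = begin
  reachCount (suc ℓ) τ N c
    ≡⟨ count-cong (ends? (suc ℓ) τ c) (λ σ → anyUpTo? (λ t → step? t σ) (suc m)) σs
                  (λ σ ((good , t , t≤m , dec , r) , σ↦c) → t , t≤m , dec , (good , r) , σ↦c)
                  (λ σ (t , t≤m , dec , (good , r) , σ↦c) → (good , t , t≤m , dec , r) , σ↦c) ⟩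
  count (λ σ → anyUpTo? (λ t → step? t σ) (suc m)) σs
    ≡⟨ count-∃ step? (suc m) σs (λ σ t≤m t′≤m (_ , (_ , r) , _) (_ , (_ , r′) , _) →
                                   reach-first-step ℓ τ σ _ _ (≤-pred t≤m) (≤-pred t′≤m) r r′) ⟩
  Σ< (suc m) (λ t → count (step? t) σs)
    ≡⟨ Σ-truncate (suc m) (suc d) (s≤s d≤m) allowed too-long ⟩
  reachCount ℓ (grow τ 0) N c + Σ< d (λ t → reachCount ℓ (grow τ (suc t)) N c)
    ≡⟨ cong₂ _+_ outer (Σ-cong d inner) ⟩
  growCoeff d m (suc ℓ) (coinv τ) c ∎
  where
  open ≡-Reasoning
  open Admissible adm
  σs = allVecs N N
  d≤m = proj₁ suffix
  step? : ∀ t → Decidable (λ σ → DecreasingSuffix m (fun τ) t × Ends ℓ (grow τ t) c {N} σ)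
  step? t σ = decreasingFrom? m (fun τ) (m ∸ t) ×-dec ends? ℓ (grow τ t) c σ
  allowed : ∀ t → t < suc d → count (step? t) σs ≡ reachCount ℓ (grow τ t) N c
  allowed t t≤d = count-cong (step? t) (ends? ℓ (grow τ t) c) σs (λ σ → proj₂)
                             (λ σ e → shorter-suffix m (fun τ) d t suffix (≤-pred t≤d) , e)
  too-long : ∀ t → suc d ≤ t → t < suc m → count (step? t) σs ≡ 0
  too-long t d<t t≤m = count-none (step? t) σs (λ σ (dec , _) → <⇒≱ d<t (proj₂ (proj₂ suffix) t (≤-pred t≤m) dec))
  size′ : 2 + m + 2 * ℓ ≡ N
  size′ = trans (sym (two-more m ℓ)) size
  outer : reachCount ℓ (grow τ 0) N c ≡ growCoeff (nextSuffix d m) (2 + m) ℓ (coinv τ) c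
  outer = trans (count-histories ℓ (grow τ 0) N (nextSuffix d m) c (grow-outer τ d adm) size′)
                (cong (λ e → growCoeff (nextSuffix d m) (2 + m) ℓ e c) (trans (coinv-grow τ 0 z≤n involutive) (+-identityʳ _)))
  inner : ∀ t → t < d → reachCount ℓ (grow τ (suc t)) N c ≡ growCoeff (suc t) (2 + m) ℓ (coinv τ + 2 * suc t) c
  inner t t<d = trans (count-histories ℓ (grow τ (suc t)) N (suc t) c (grow-inner τ d t t<d adm) size′)
                      (cong (λ e → growCoeff (suc t) (2 + m) ℓ e c) (coinv-grow τ (suc t) (≤-trans t<d d≤m) involutive))

-- Closed forms of the generating-tree recursion.  As long as the involution is
-- not entirely decreasing (d < m), the suffix length d plays the role of the
-- bound of A_{d+1,ℓ}.
growCoeff-partial : ∀ ℓ d m e c → d < m → growCoeff d m ℓ e c ≡ aCoeff (suc d) ℓ e c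
growCoeff-partial zero    d m e c _   = refl
growCoeff-partial (suc ℓ) d m e c d<m = cong₂ _+_
  (trans (cong (λ d′ → growCoeff d′ (2 + m) ℓ e c) (nextSuffix-< d m d<m))
         (growCoeff-partial ℓ (suc d) (2 + m) e c (s≤s (≤-trans d<m (n≤1+n m)))))
  (Σ-cong d (λ t t<d → growCoeff-partial ℓ (suc t) (2 + m) _ c (s≤s (≤-trans (<-trans t<d d<m) (n≤1+n m)))))

-- For an entirely decreasing involution of [0, m), each history first inserts
-- i outermost 2-cycles, staying entirely decreasing, and then continues as
-- counted by B_{m+2i+1,ℓ-i}.
growCoeff-full : ∀ ℓ m e c → growCoeff m m ℓ e c ≡ Σ< (suc ℓ) (λ i → bCoeff (suc (m + 2 * i)) (ℓ ∸ i) e c)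
growCoeff-full zero    m e c = sym (trans (+-identityʳ _) (cong (λ m′ → bCoeff (suc m′) 0 e c) (+-identityʳ m)))
growCoeff-full (suc ℓ) m e c = begin
  growCoeff (nextSuffix m m) (2 + m) ℓ e c + Σ< m (λ t → growCoeff (suc t) (2 + m) ℓ (e + 2 * suc t) c)
    ≡⟨ cong₂ _+_ (trans (cong (λ d → growCoeff d (2 + m) ℓ e c) (nextSuffix-≥ m m ≤-refl)) (growCoeff-full ℓ (2 + m) e c))
                 (Σ-cong m (λ t t<m → growCoeff-partial ℓ (suc t) (2 + m) _ c (s≤s (≤-trans t<m (n≤1+n m))))) ⟩
  Σ< (suc ℓ) (λ i → bCoeff (suc (2 + m + 2 * i)) (ℓ ∸ i) e c) + bCoeff (suc m) (suc ℓ) e c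
    ≡⟨ +-comm _ (bCoeff (suc m) (suc ℓ) e c) ⟩
  bCoeff (suc m) (suc ℓ) e c + Σ< (suc ℓ) (λ i → bCoeff (suc (2 + m + 2 * i)) (ℓ ∸ i) e c)
    ≡⟨ cong₂ _+_ (cong (λ m′ → bCoeff (suc m′) (suc ℓ) e c) (sym (+-identityʳ m)))
                 (Σ-cong (suc ℓ) (λ i _ → cong (λ m′ → bCoeff (suc m′) (ℓ ∸ i) e c) (sym (two-more m i)))) ⟩
  Σ< (2 + ℓ) (λ i → bCoeff (suc (m + 2 * i)) (suc ℓ ∸ i) e c) ∎
  where open ≡-Reasoning

headV : ∀ s → Vec (Fin s) s
headV s = vec s (headFixed s) (headFixed-range s)

≈headV : ∀ s → headFixed s ≈[ s ] fun (headV s)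
≈headV s i i<s = sym (fun-vec s (headFixed s) (headFixed-range s) i i<s)

headV-admissible₁ : Admissible 1 (headV 1) 1
headV-admissible₁ = record
  { involutive = involutive-≈ 1 (headFixed 1) _ (≈headV 1) (headFixed-range 1) (headFixed-involutive 1)
  ; avoids     = avoids-≈ 1 (headFixed 1) _ (≈headV 1) (headFixed-avoids 1)
  ; suffix     = longestDecSuffix-≈ 1 (headFixed 1) _ 1 (≈headV 1) headFixed-suffix₁
  }

headV-admissible : ∀ m → Admissible (2 + m) (headV (2 + m)) (suc m)
headV-admissible m = record
  { involutive = involutive-≈ (2 + m) (headFixed (2 + m)) _ (≈headV (2 + m)) (headFixed-range (2 + m)) (headFixed-involutive (2 + m))
  ; avoids     = avoids-≈ (2 + m) (headFixed (2 + m)) _ (≈headV (2 + m)) (headFixed-avoids (2 + m))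
  ; suffix     = longestDecSuffix-≈ (2 + m) (headFixed (2 + m)) _ (suc m) (≈headV (2 + m)) (headFixed-suffix m)
  }

coinv-headV : ∀ m → coinv (headV (suc m)) ≡ m
coinv-headV m = trans (coinv≡coinvOn (headV (suc m))) (trans (sym (coinvOn-≈ (suc m) _ _ (≈headV (suc m)))) (coinv-headFixed m))

reach-≈ : ∀ ℓ {m} (ρ : Vec (Fin m) m) {N} (σ σ′ : Vec (Fin N) N) → fun σ ≈[ N ] fun σ′ → Reach ℓ ρ σ → Reach ℓ ρ σ′
reach-≈ zero    ρ σ σ′ σ≈σ′ (refl , ρ≈σ)          = refl , λ i i<m → trans (ρ≈σ i i<m) (σ≈σ′ i i<m)
reach-≈ (suc ℓ) ρ σ σ′ σ≈σ′ (t , t≤m , dec , r) = t , t≤m , dec , reach-≈ ℓ (grow ρ t) σ σ′ σ≈σ′ r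

reach-snoc : ∀ ℓ {m} (ρ : Vec (Fin m) m) {M} (τ : Vec (Fin M) M) t (σ : Vec (Fin (2 + M)) (2 + M)) →
             Reach ℓ ρ τ → DecreasingSuffix M (fun τ) t → t ≤ M → fun (grow τ t) ≈[ 2 + M ] fun σ → Reach (suc ℓ) ρ σ
reach-snoc zero {m} ρ τ t σ (refl , ρ≈τ) dec t≤M agree =
  t , s≤s t≤M , decreasingFrom-≈ m (fun τ) (fun ρ) _ (λ i i<m → sym (ρ≈τ i i<m)) dec , refl ,
  λ i i<n → trans (fun-grow ρ t i i<n)
           (trans (insert-≈ m (m ∸ t) (fun ρ) (fun τ) (m∸n≤m m t) ρ≈τ i i<n) (trans (sym (fun-grow τ t i i<n)) (agree i i<n)))
reach-snoc (suc ℓ) ρ τ t σ (t₀ , t₀≤m , dec₀ , r₀) dec t≤M agree =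
  t₀ , t₀≤m , dec₀ , reach-snoc ℓ (grow ρ t₀) τ t σ r₀ dec t≤M agree

record LastStep (ℓ : ℕ) {m} (ρ : Vec (Fin m) m) {N} (σ : Vec (Fin N) N) : Set where
  constructor lastStep
  field
    M      : ℕ
    size   : N ≡ 2 + M
    τ      : Vec (Fin M) M
    t      : ℕ
    t≤M    : t ≤ M
    before : Reach ℓ ρ τ
    agree  : ∀ i → i < N → fun σ i ≡ insert (M ∸ t) (fun τ) i

last-step : ∀ ℓ {m} (ρ : Vec (Fin m) m) {N} (σ : Vec (Fin N) N) → Reach (suc ℓ) ρ σ → LastStep ℓ ρ σ
last-step zero    {m} ρ σ (t , t≤m , _ , refl , ρ′≈σ) =
  lastStep m refl ρ t (≤-pred t≤m) (refl , λ _ _ → refl) (λ i i<n → trans (sym (ρ′≈σ i i<n)) (fun-grow ρ t i i<n))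
last-step (suc ℓ) ρ σ (t , t≤m , dec , r) with last-step ℓ (grow ρ t) σ r
... | lastStep M size τ t′ t′≤M before agree = lastStep M size τ t′ t′≤M (t , t≤m , dec , before) agree

reach-fixed : ∀ {s N} (σ : Vec (Fin N) N) → 1 ≤ s → Reach 0 (headV s) σ → fun σ 0 ≡ 0
reach-fixed σ 1≤s (refl , agree) = trans (sym (agree 0 1≤s)) (sym (≈headV _ 0 1≤s))

last-step-moves : ∀ {ℓ m N} {ρ : Vec (Fin m) m} {σ : Vec (Fin N) N} → LastStep ℓ ρ σ → fun σ 0 ≢ 0
last-step-moves (lastStep M refl τ t t≤M before agree) σ0≡0 = 1+n≢0 (trans (sym (agree 0 (s≤s z≤n))) σ0≡0)

reach-length-unique : ∀ ℓ ℓ′ s s′ {N} (σ : Vec (Fin N) N) → 1 ≤ s → 1 ≤ s′ →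
                      Reach ℓ (headV s) σ → Reach ℓ′ (headV s′) σ → ℓ ≡ ℓ′
reach-length-unique zero    zero     s s′ σ _   _    _ _ = refl
reach-length-unique zero    (suc ℓ′) s s′ σ 1≤s _    r r′ =
  ⊥-elim (last-step-moves (last-step ℓ′ (headV s′) σ r′) (reach-fixed σ 1≤s r))
reach-length-unique (suc ℓ) zero     s s′ σ _   1≤s′ r r′ =
  ⊥-elim (last-step-moves (last-step ℓ (headV s) σ r) (reach-fixed σ 1≤s′ r′))
reach-length-unique (suc ℓ) (suc ℓ′) s s′ σ 1≤s 1≤s′ r r′ =
  cong suc (peel (last-step ℓ (headV s) σ r) (last-step ℓ′ (headV s′) σ r′))
  where
  -- both last steps remove the same 2-cycle, leaving the same involution
  peel : LastStep ℓ (headV s) σ → LastStep ℓ′ (headV s′) σ → ℓ ≡ ℓ′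
  peel (lastStep M refl τ t t≤M before agree) (lastStep M′ size′ τ′ t′ _ before′ agree′) with suc-injective (suc-injective size′)
  ... | refl = reach-length-unique ℓ ℓ′ s s′ τ 1≤s 1≤s′ before (reach-≈ ℓ′ (headV s′) τ′ τ τ′≈τ before′)
    where
    τ′≈τ : fun τ′ ≈[ M ] fun τ
    τ′≈τ x x<M = sym (proj₂ (insert-injective M (M ∸ t) (M ∸ t′) (fun τ) (fun τ′) (m∸n≤m M t)
                               (λ i i<n → trans (sym (agree i i<n)) (agree′ i i<n))) x x<M)

-- Every 123-avoiding involution is grown from an involution fixing 0, by
-- removing the 2-cycle through 0 as long as 0 is not fixed.
decompose : ∀ N (σ : Vec (Fin N) N) → Involutive N (fun σ) → Avoids123 N (fun σ) →
            Σ ℕ λ s → Σ ℕ λ ℓ → s + 2 * ℓ ≡ N × Reach ℓ (headV s) σ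
decompose zero    σ _ _ = 0 , 0 , refl , refl , λ _ ()
decompose (suc N) σ involutive avoids with fun σ 0 ≟ 0
... | yes σ0≡0 = suc N , 0 , +-identityʳ _ , refl , λ i i<n →
  trans (sym (≈headV (suc N) i i<n)) (sym (headFixed-unique (suc N) (fun σ) (fun-range σ) involutive avoids σ0≡0 i i<n))
decompose 1             σ involutive avoids | no σ0≢0 = ⊥-elim (σ0≢0 (n<1⇒n≡0 (fun-range σ 0 (s≤s z≤n))))
decompose (suc (suc m)) σ involutive avoids | no σ0≢0 =
  add-last-step (decompose m τ (involutive-≈ m F (fun τ) F≈τ F-range F-involutive) (avoids-≈ m F (fun τ) F≈τ F-avoids))
  where
  open Removal m (fun σ) (fun-range σ) involutive avoids σ0≢0
  τ = vec m F F-range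
  F≈τ : F ≈[ m ] fun τ
  F≈τ i i<m = sym (fun-vec m F F-range i i<m)
  dec : DecreasingSuffix m (fun τ) (m ∸ b)
  dec = subst (DecreasingFrom m (fun τ)) (sym (m∸[m∸n]≡n b≤m)) (decreasingFrom-≈ m F (fun τ) b F≈τ F-decreasing)
  agree : fun (grow τ (m ∸ b)) ≈[ 2 + m ] fun σ
  agree i i<n = trans (fun-grow τ (m ∸ b) i i<n)
               (trans (cong (λ b′ → insert b′ (fun τ) i) (m∸[m∸n]≡n b≤m))
               (trans (insert-≈ m b (fun τ) F b≤m (λ j j<m → sym (F≈τ j j<m)) i i<n) (insert-removal i i<n)))
  add-last-step : (Σ ℕ λ s → Σ ℕ λ ℓ → s + 2 * ℓ ≡ m × Reach ℓ (headV s) τ) →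
                  Σ ℕ λ s → Σ ℕ λ ℓ → s + 2 * ℓ ≡ 2 + m × Reach ℓ (headV s) σ
  add-last-step (s , ℓ , size , r) =
    s , suc ℓ , trans (two-more s ℓ) (cong (2 +_) size) , reach-snoc ℓ (headV s) τ (m ∸ b) σ r dec (m∸n≤m m b) agree

odd-start : ∀ s ℓ k → s + 2 * ℓ ≡ suc (2 * k) → ℓ ≤ k × s ≡ suc (2 * (k ∸ ℓ))
odd-start s zero    k       size = z≤n , trans (sym (+-identityʳ s)) size
odd-start s (suc ℓ) zero    size = ⊥-elim (1+n≢0 (suc-injective (trans (sym (two-more s ℓ)) size)))
odd-start s (suc ℓ) (suc k) size =
  let (ℓ≤k , s≡) = odd-start s ℓ k (suc-injective (suc-injective (trans (sym (two-more s ℓ)) (trans size (cong suc (two-more 0 k))))))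
  in s≤s ℓ≤k , s≡

count-by-start : ∀ k c → count (good? ∩? (λ σ → coinv σ ≟ c)) (allVecs (suc (2 * k)) (suc (2 * k))) ≡
                         Σ< (suc k) (λ j → reachCount (k ∸ j) (headV (suc (2 * j))) (suc (2 * k)) c)
count-by-start k c =
  trans (count-cong _ (λ σ → anyUpTo? (λ j → start? j σ) (suc k)) σs split join)
        (count-∃ start? (suc k) σs unique)
  where
  N = suc (2 * k)
  σs = allVecs N N
  start? : ∀ j → Decidable (Ends (k ∸ j) (headV (suc (2 * j))) c {N})
  start? j = ends? (k ∸ j) (headV (suc (2 * j))) c
  split : ∀ σ → Good σ × coinv σ ≡ c → ∃ λ j → j < suc k × Ends (k ∸ j) (headV (suc (2 * j))) c σ
  split σ (good , σ↦c) with decompose N σ (involution⇒ σ (proj₁ good)) (proj₂ good ∘ contains⇐ σ)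
  ... | s , ℓ , size , r with odd-start s ℓ k size
  ...   | ℓ≤k , refl = k ∸ ℓ , s≤s (m∸n≤m k ℓ) ,
                       (good , subst (λ ℓ′ → Reach ℓ′ (headV (suc (2 * (k ∸ ℓ)))) σ) (sym (m∸[m∸n]≡n ℓ≤k)) r) , σ↦c
  join : ∀ σ → (∃ λ j → j < suc k × Ends (k ∸ j) (headV (suc (2 * j))) c σ) → Good σ × coinv σ ≡ c
  join σ (_ , _ , (good , _) , σ↦c) = good , σ↦c
  unique : ∀ {j j′} σ → j < suc k → j′ < suc k → Ends (k ∸ j) (headV (suc (2 * j))) c σ →
           Ends (k ∸ j′) (headV (suc (2 * j′))) c σ → j ≡ j′
  unique σ j≤k j′≤k ((_ , r) , _) ((_ , r′) , _) =
    ∸-cancelˡ-≡ (≤-pred j≤k) (≤-pred j′≤k) (reach-length-unique _ _ _ _ σ (s≤s z≤n) (s≤s z≤n) r r′)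

aTerms bTerms : ℕ → ℕ → ℕ
aTerms k c = Σ< k (λ j → aCoeff (2 * suc j + 1) (k ∸ suc j) (2 * suc j) c)
bTerms k c = Σ< (suc k) (λ j → bCoeff (2 * j + 2) (k ∸ j) 0 c)

histories-from-point : ∀ k c → reachCount k (headV 1) (suc (2 * k)) c ≡ bTerms k c
histories-from-point k c = begin
  reachCount k (headV 1) (suc (2 * k)) c                   ≡⟨ count-histories k (headV 1) (suc (2 * k)) 1 c headV-admissible₁ refl ⟩
  growCoeff 1 1 k (coinv (headV 1)) c                      ≡⟨ cong (λ e → growCoeff 1 1 k e c) (coinv-headV 0) ⟩
  growCoeff 1 1 k 0 c                                      ≡⟨ growCoeff-full k 1 0 c ⟩
  Σ< (suc k) (λ j → bCoeff (suc (1 + 2 * j)) (k ∸ j) 0 c) ≡⟨ Σ-cong (suc k) (λ j _ → cong (λ m → bCoeff m (k ∸ j) 0 c)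
                                                                                      (+-comm 2 (2 * j))) ⟩
  bTerms k c                                               ∎
  where open ≡-Reasoning

histories-from-larger : ∀ k c j → j < k →
  reachCount (k ∸ suc j) (headV (suc (2 * suc j))) (suc (2 * k)) c ≡ aCoeff (2 * suc j + 1) (k ∸ suc j) (2 * suc j) c
histories-from-larger k c j j<k = begin
  reachCount (k ∸ suc j) (headV (suc (2 * suc j))) (suc (2 * k)) c
    ≡⟨ count-histories (k ∸ suc j) (headV (suc (2 * suc j))) (suc (2 * k)) (2 * suc j) c (headV-admissible _) size ⟩
  growCoeff (2 * suc j) (suc (2 * suc j)) (k ∸ suc j) (coinv (headV (suc (2 * suc j)))) c
    ≡⟨ cong (λ e → growCoeff (2 * suc j) (suc (2 * suc j)) (k ∸ suc j) e c) (coinv-headV (2 * suc j)) ⟩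
  growCoeff (2 * suc j) (suc (2 * suc j)) (k ∸ suc j) (2 * suc j) c
    ≡⟨ growCoeff-partial (k ∸ suc j) (2 * suc j) (suc (2 * suc j)) (2 * suc j) c ≤-refl ⟩
  aCoeff (suc (2 * suc j)) (k ∸ suc j) (2 * suc j) c
    ≡⟨ cong (λ m → aCoeff m (k ∸ suc j) (2 * suc j) c) (+-comm 1 (2 * suc j)) ⟩
  aCoeff (2 * suc j + 1) (k ∸ suc j) (2 * suc j) c ∎
  where
  open ≡-Reasoning
  size : suc (2 * suc j) + 2 * (k ∸ suc j) ≡ suc (2 * k)
  size = cong suc (trans (sym (*-distribˡ-+ 2 (suc j) (k ∸ suc j))) (cong (2 *_) (m+[n∸m]≡n j<k)))

lhs-coeff : ∀ k c → coeff (lhs k) c ≡ aTerms k c + bTerms k c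
lhs-coeff k c = begin
  coeff (lhs k) c
    ≡⟨ count-map (_≟ c) coinv (Inv123 N) ⟩
  count (λ σ → coinv σ ≟ c) (Inv123 N)
    ≡⟨ count-filter (¬? ∘ contains123?) (λ σ → coinv σ ≟ c) (filter isInvolution? σs) ⟩
  count ((¬? ∘ contains123?) ∩? (λ σ → coinv σ ≟ c)) (filter isInvolution? σs)
    ≡⟨ count-filter isInvolution? ((¬? ∘ contains123?) ∩? (λ σ → coinv σ ≟ c)) σs ⟩
  count (isInvolution? ∩? ((¬? ∘ contains123?) ∩? (λ σ → coinv σ ≟ c))) σs
    ≡⟨ count-cong _ (good? ∩? (λ σ → coinv σ ≟ c)) σs (λ σ (inv , avoid , σ↦c) → (inv , avoid) , σ↦c)
                                                       (λ σ ((inv , avoid) , σ↦c) → inv , avoid , σ↦c) ⟩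
  count (good? ∩? (λ σ → coinv σ ≟ c)) σs
    ≡⟨ count-by-start k c ⟩
  reachCount k (headV 1) N c + Σ< k (λ j → reachCount (k ∸ suc j) (headV (suc (2 * suc j))) N c)
    ≡⟨ +-comm (reachCount k (headV 1) N c) _ ⟩
  Σ< k (λ j → reachCount (k ∸ suc j) (headV (suc (2 * suc j))) N c) + reachCount k (headV 1) N c
    ≡⟨ cong₂ _+_ (Σ-cong k (histories-from-larger k c)) (histories-from-point k c) ⟩
  aTerms k c + bTerms k c ∎
  where
  open ≡-Reasoning
  N = suc (2 * k)
  σs = allVecs N N

aSet-coeff : ∀ m ℓ e c → count (_≟ c) (map (λ a → e + 2 * wt a) (Aset (suc m) ℓ)) ≡ aCoeff (suc m) ℓ e c
aSet-coeff m ℓ e c =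
  trans (count-map (_≟ c) _ (Aset (suc m) ℓ))
        (trans (count-filter (inA? (suc m)) _ (candidates (suc m) ℓ)) (aCount ℓ (suc m + ℓ) m e c ≤-refl))

bSet-coeff : ∀ m ℓ c → count (_≟ c) (map (λ a → 2 * wt a) (Bset (suc m) ℓ)) ≡ bCoeff (suc m) ℓ 0 c
bSet-coeff m ℓ c =
  trans (count-map (_≟ c) _ (Bset (suc m) ℓ))
        (trans (count-filter firstNotOne? _ (Aset (suc m) ℓ))
        (trans (count-filter (inA? (suc m)) _ (candidates (suc m) ℓ)) (bCount ℓ (suc m + ℓ) m 0 c ≤-refl)))

rhs-coeff : ∀ k c → coeff (rhs k) c ≡ aTerms k c + bTerms k c
rhs-coeff k c = begin
  coeff (rhs k) c
    ≡⟨ count-++ (_≟ c) (concatMap aPart (values k)) (concatMap bPart (upTo (suc k))) ⟩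
  count (_≟ c) (concatMap aPart (values k)) + count (_≟ c) (concatMap bPart (upTo (suc k)))
    ≡⟨ cong₂ _+_ (count-concatMap (_≟ c) aPart (values k)) (count-concatMap (_≟ c) bPart (upTo (suc k))) ⟩
  sum (map (count (_≟ c) ∘ aPart) (map suc (upTo k))) + sum (map (count (_≟ c) ∘ bPart) (upTo (suc k)))
    ≡⟨ cong (_+ sum (map (count (_≟ c) ∘ bPart) (upTo (suc k)))) (cong sum (sym (map-∘ (upTo k)))) ⟩
  sum (map (count (_≟ c) ∘ aPart ∘ suc) (upTo k)) + sum (map (count (_≟ c) ∘ bPart) (upTo (suc k)))
    ≡⟨ cong₂ _+_ (sum-upTo k _) (sum-upTo (suc k) _) ⟩
  Σ< k (count (_≟ c) ∘ aPart ∘ suc) + Σ< (suc k) (count (_≟ c) ∘ bPart)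
    ≡⟨ cong₂ _+_ (Σ-cong k (λ j _ → aSet-coeff _ (k ∸ suc j) (2 * suc j) c)) (Σ-cong (suc k) (λ j _ → b-term j)) ⟩
  aTerms k c + bTerms k c ∎
  where
  open ≡-Reasoning
  aPart bPart : ℕ → List ℕ
  aPart j = map (λ a → 2 * j + 2 * wt a) (Aset (2 * j + 1) (k ∸ j))
  bPart j = map (λ a → 2 * wt a) (Bset (2 * j + 2) (k ∸ j))
  b-term : ∀ j → count (_≟ c) (bPart j) ≡ bCoeff (2 * j + 2) (k ∸ j) 0 c
  b-term j rewrite +-comm (2 * j) 2 = bSet-coeff (suc (2 * j)) (k ∸ j) c

theorem3p20 : (k d : ℕ) → coeff (lhs k) d ≡ coeff (rhs k) d
theorem3p20 k d = trans (lhs-coeff k d) (sym (rhs-coeff k d))
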